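{- For every integer $n\geq 0$ and every integer $j\geq 1$, $$\sum_{k=0}^{\lfloor n/2\rfloor}\binom{n}{2k}(20^k-5^k)F_{2j}^{2k}\,B_{2k}\,L_{2j(n-2k)} = \frac{5n}{2}F_{2j}F_{2j(n-1)}.$$
   Context: $B_n$ denotes the $n$-th Bernoulli number, defined by $\sum_{n\ge0}B_n\frac{z^n}{n!}=\frac{z}{e^z-1}$. $F_n$ and $L_n$ are the Fibonacci and Lucas numbers: $F_0=0,F_1=1$, $L_0=2,L_1=1$, and $X_n=X_{n-1}+X_{n-2}$ for $n\ge2$. For $n=0$ the right-hand side, which carries the factor $n$, is interpreted as $0$. -}

module Defs where

open import Data.Nat as ℕ using (ℕ; zero; suc)
open import Data.Nat.Combinatorics using (_C_)
open import Data.Integer using (+_)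
open import Data.Rational using (ℚ; _/_; 0ℚ; 1ℚ; _+_; _*_; -_)
open import Data.Fin using (Fin; fromℕ; fromℕ<)
open import Data.Vec using (Vec; []; _∷_; _∷ʳ_; lookup)

import Relation.Nullary

ℕ→ℚ : ℕ → ℚ
ℕ→ℚ n = + n / 1

sumTo : ℕ → (ℕ → ℚ) → ℚ
sumTo zero    f = f 0
sumTo (suc m) f = sumTo m f + f (suc m)

fib : ℕ → ℕ
fib 0             = 0
fib 1             = 1
fib (suc (suc n)) = fib (suc n) ℕ.+ fib n

lucas : ℕ → ℕ
lucas 0             = 2
lucas 1             = 1
lucas (suc (suc n)) = lucas (suc n) ℕ.+ lucas n

-- Bernoulli numbers with Σ B_n z^n/n! = z/(e^z - 1).
-- Comparing coefficients of z^(m+1) in z = (e^z - 1)·Σ B_n z^n/n! gives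
-- B_0 = 1 and Σ_{k=0}^{m} C(m+1,k) B_k = 0 for m ≥ 1, i.e.
-- B_{m+1} = -(1/(m+2)) Σ_{k=0}^{m} C(m+2,k) B_k.
-- bernVec n = (B_0, …, B_n).
bernVec : (n : ℕ) → Vec ℚ (suc n)
bernVec zero    = 1ℚ ∷ []
bernVec (suc n) = prev ∷ʳ next
  where
  prev : Vec ℚ (suc n)
  prev = bernVec n
  term : ℕ → ℚ
  term k with k ℕ.≤? n
  ... | Relation.Nullary.yes k≤n = ℕ→ℚ ((n ℕ.+ 2) C k) * lookup prev (fromℕ< (ℕ.s≤s k≤n))
  ... | Relation.Nullary.no _   = 0ℚ
  next : ℚ
  next = - ((+ 1 / suc (suc n)) * sumTo n term)

B : ℕ → ℚ
B n = lookup (bernVec n) (fromℕ n)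

{-# OPTIONS --safe #-}
module Submission where

-- In ℚ(√5) put φ, ψ = (1 ± √5)/2, α = φ^{2j}, β = ψ^{2j} and d = α − β = √5 F_{2j}, so that
-- L_{2jm} = α^m + β^m and d^{2k} = 5^k F_{2j}^{2k}. With T(z) = Σ_k (4^k − 1) B_{2k} z^{2k}/(2k)!,
-- the sum is n! [zⁿ] T(dz)(e^{αz} + e^{βz}). From B(z)(eᶻ − 1) = z one gets B(2z)(eᶻ + 1) = 2B(z),
-- so G(z) = B(2z) − B(z) = −z/(eᶻ + 1); T is the even part of G, i.e. (z/2) tanh(z/2), hence
-- T(z)(eᶻ + 1) = (z/2)(eᶻ − 1). As α = β + d, T(dz)(e^{αz} + e^{βz}) = (dz/2)(e^{αz} − e^{βz}),
-- and n! [zⁿ] of this is (n d/2)(α^{n−1} − β^{n−1}) = (5n/2) F_{2j} F_{2j(n−1)}.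

open import Level using (0ℓ)
open import Algebra.Core using (Op₁; Op₂)
open import Algebra.Bundles using (CommutativeRing; Semiring)
open import Algebra.Structures using (IsCommutativeRing)
open import Algebra.Consequences.Propositional using (comm∧idˡ⇒id; comm∧invˡ⇒inv; comm∧distrˡ⇒distrʳ)
import Algebra.Properties.CommutativeSemigroup
open import Data.Nat.Base as ℕ using (ℕ; zero; suc; _∸_; _≤_; _<_; z≤n; s≤s)
import Data.Nat.Properties as ℕ
open import Data.Nat.DivMod using (_/_; m/n≡1+[m∸n]/n)
open import Data.Nat.Induction using (<-rec)
open import Data.Nat.Combinatorics using (_C_; nCn≡1; nC1≡n; nCk≡nC[n∸k]; nCk+nC[k+1]≡[n+1]C[k+1]; k>n⇒nCk≡0)
open import Data.Nat.Tactic.RingSolver using () renaming (solve-∀ to ℕ-solve-∀)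
import Data.Nat.Coprimality as Coprime
import Data.Integer.Base as ℤ
import Data.Integer.Properties as ℤ
open import Data.Rational.Base as ℚ using (ℚ; mkℚ; 0ℚ; 1ℚ; ½)
import Data.Rational.Properties as ℚ
open import Data.Fin.Base using (fromℕ; fromℕ<)
import Data.Fin.Properties as Fin
open import Data.Vec.Base using (Vec; []; _∷_; _∷ʳ_; lookup)
open import Data.Product.Base using (Σ; _,_; proj₁; proj₂)
open import Data.Sum.Base as Sum using (_⊎_; inj₁; inj₂)
open import Data.Maybe.Base using (Maybe; just; nothing)
open import Function.Base using (_∘_)
open import Relation.Nullary using (yes; no; contradiction)
open import Relation.Nullary.Decidable.Core using (dec⇒maybe)
open import Relation.Binary.PropositionalEquality
open import Tactic.RingSolver using (solve-∀)
import Tactic.RingSolver.Core.AlmostCommutativeRing as ACR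

open import Defs

n≡2*[n/2]⊎n≡1+2*[n/2] : ∀ n → n ≡ 2 ℕ.* (n / 2) ⊎ n ≡ suc (2 ℕ.* (n / 2))
n≡2*[n/2]⊎n≡1+2*[n/2] zero          = inj₁ refl
n≡2*[n/2]⊎n≡1+2*[n/2] (suc zero)    = inj₂ refl
n≡2*[n/2]⊎n≡1+2*[n/2] (suc (suc n)) =
  Sum.map (λ eq → trans (cong (2 ℕ.+_) eq) double-half)
          (λ eq → trans (cong (2 ℕ.+_) eq) (cong suc double-half))
          (n≡2*[n/2]⊎n≡1+2*[n/2] n)
  where
  double-half : 2 ℕ.+ 2 ℕ.* (n / 2) ≡ 2 ℕ.* (suc (suc n) / 2)
  double-half = sym (trans (cong (2 ℕ.*_) (m/n≡1+[m∸n]/n {suc (suc n)} (s≤s (s≤s z≤n)))) (ℕ.*-suc 2 (n / 2)))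

[1+n]Cn≡1+n : ∀ n → suc n C n ≡ suc n
[1+n]Cn≡1+n n = begin
  suc n C n              ≡⟨ nCk≡nC[n∸k] (ℕ.n≤1+n n) ⟩
  suc n C (suc n ∸ n)    ≡⟨ cong (suc n C_) (ℕ.m+n∸n≡m 1 n) ⟩
  suc n C 1              ≡⟨ nC1≡n (suc n) ⟩
  suc n                  ∎
  where open ≡-Reasoning

^-distribʳ-* : ∀ m n k → (m ℕ.* n) ℕ.^ k ≡ m ℕ.^ k ℕ.* n ℕ.^ k
^-distribʳ-* m n zero    = refl
^-distribʳ-* m n (suc k) = trans (cong (m ℕ.* n ℕ.*_) (^-distribʳ-* m n k)) (interchange m n (m ℕ.^ k) (n ℕ.^ k))
  where
  interchange : ∀ m n a b → m ℕ.* n ℕ.* (a ℕ.* b) ≡ m ℕ.* a ℕ.* (n ℕ.* b)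
  interchange = ℕ-solve-∀

module ExponentialSeries
  {A : Set} {_+ᴬ_ _*ᴬ_ : Op₂ A} { -ᴬ_ : Op₁ A} {0ᴬ 1ᴬ : A}
  (isCommutativeRing : IsCommutativeRing _≡_ _+ᴬ_ _*ᴬ_ -ᴬ_ 0ᴬ 1ᴬ)
  where

  commutativeRing : CommutativeRing 0ℓ 0ℓ
  commutativeRing = record { isCommutativeRing = isCommutativeRing }

  open CommutativeRing commutativeRing public
    using (_+_; _*_; -_; _-_; 0#; 1#)
  open CommutativeRing commutativeRing
    using ( +-assoc; +-comm; +-identityˡ; +-identityʳ; -‿inverseʳ
          ; *-assoc; *-comm; *-identityˡ; *-identityʳ; distribˡ; distribʳ; zeroˡ; zeroʳ
          ; semiring; ring; +-abelianGroup; +-commutativeMonoid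
          ; +-commutativeSemigroup; *-commutativeSemigroup )
  open import Algebra.Definitions.RawSemiring (Semiring.rawSemiring semiring) public using (_×_; _^_)
  open import Algebra.Properties.Semiring.Mult semiring
    using (×-homo-0; ×-homo-1; ×-homo-+; ×-comm-*; ×-assoc-*)
  open import Algebra.Properties.CommutativeMonoid.Mult +-commutativeMonoid using (×-distrib-+)
  open import Algebra.Properties.CommutativeSemigroup +-commutativeSemigroup using (interchange; x∙yz≈y∙xz)
  open import Algebra.Properties.AbelianGroup +-abelianGroup using (identityˡ-unique; x∙y⁻¹≈ε⇒x≈y; ⁻¹-∙-comm)
  open import Algebra.Properties.Ring ring using (-1*x≈-x)
  module * = Algebra.Properties.CommutativeSemigroup *-commutativeSemigroup
  open ≡-Reasoning

  ×-zeroʳ : ∀ n → n × 0# ≡ 0#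
  ×-zeroʳ n = begin
    n × 0#          ≡⟨ cong (n ×_) (sym (zeroˡ 0#)) ⟩
    n × (0# * 0#)   ≡⟨ ×-comm-* n 0# 0# ⟨
    0# * (n × 0#)   ≡⟨ zeroˡ (n × 0#) ⟩
    0#              ∎

  ×≡×1* : ∀ n x → n × x ≡ (n × 1#) * x
  ×≡×1* n x = trans (cong (n ×_) (sym (*-identityˡ x))) (sym (×-assoc-* n 1# x))

  1^n≡1 : ∀ n → 1# ^ n ≡ 1#
  1^n≡1 zero    = refl
  1^n≡1 (suc n) = trans (*-identityˡ (1# ^ n)) (1^n≡1 n)

  ∑≤ : ℕ → (ℕ → A) → A
  ∑≤ zero    f = f 0
  ∑≤ (suc n) f = ∑≤ n f + f (suc n)

  ∑≤-cong : ∀ n {f g : ℕ → A} → (∀ {k} → k ≤ n → f k ≡ g k) → ∑≤ n f ≡ ∑≤ n g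
  ∑≤-cong zero    f≗g = f≗g z≤n
  ∑≤-cong (suc n) f≗g = cong₂ _+_ (∑≤-cong n (f≗g ∘ ℕ.m≤n⇒m≤1+n)) (f≗g ℕ.≤-refl)

  ∑≤-+ : ∀ n (f g : ℕ → A) → ∑≤ n (λ k → f k + g k) ≡ ∑≤ n f + ∑≤ n g
  ∑≤-+ zero    f g = refl
  ∑≤-+ (suc n) f g = trans (cong (_+ (f (suc n) + g (suc n))) (∑≤-+ n f g))
                           (interchange (∑≤ n f) (∑≤ n g) (f (suc n)) (g (suc n)))

  ∑≤-*ˡ : ∀ n c (f : ℕ → A) → ∑≤ n (λ k → c * f k) ≡ c * ∑≤ n f
  ∑≤-*ˡ zero    c f = refl
  ∑≤-*ˡ (suc n) c f = trans (cong (_+ c * f (suc n)) (∑≤-*ˡ n c f))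
                            (sym (distribˡ c (∑≤ n f) (f (suc n))))

  ∑≤-zero : ∀ n {f : ℕ → A} → (∀ {k} → k ≤ n → f k ≡ 0#) → ∑≤ n f ≡ 0#
  ∑≤-zero zero    f≡0 = f≡0 z≤n
  ∑≤-zero (suc n) f≡0 = begin
    ∑≤ n _ + _   ≡⟨ cong₂ _+_ (∑≤-zero n (f≡0 ∘ ℕ.m≤n⇒m≤1+n)) (f≡0 ℕ.≤-refl) ⟩
    0# + 0#      ≡⟨ +-identityˡ 0# ⟩
    0#           ∎

  ∑≤-lastOnly : ∀ n {f : ℕ → A} → (∀ {k} → k < n → f k ≡ 0#) → ∑≤ n f ≡ f n
  ∑≤-lastOnly zero    _   = refl
  ∑≤-lastOnly (suc n) f≡0 = trans (cong (_+ _) (∑≤-zero n (f≡0 ∘ s≤s))) (+-identityˡ _)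

  ∑≤-unfoldˡ : ∀ n (f : ℕ → A) → ∑≤ (suc n) f ≡ f 0 + ∑≤ n (f ∘ suc)
  ∑≤-unfoldˡ zero    f = refl
  ∑≤-unfoldˡ (suc n) f = trans (cong (_+ f (suc (suc n))) (∑≤-unfoldˡ n f)) (+-assoc (f 0) _ _)

  ∑≤-double : ∀ m (f : ℕ → A) → (∀ i → f (suc (2 ℕ.* i)) ≡ 0#) → ∑≤ (2 ℕ.* m) f ≡ ∑≤ m (f ∘ (2 ℕ.*_))
  ∑≤-double zero    f odd≡0 = refl
  ∑≤-double (suc m) f odd≡0 = begin
    ∑≤ (2 ℕ.* suc m) f                                        ≡⟨ cong (λ n → ∑≤ n f) (ℕ.*-suc 2 m) ⟩
    ∑≤ (2 ℕ.* m) f + f (suc (2 ℕ.* m)) + f (2 ℕ.+ 2 ℕ.* m)    ≡⟨ cong₂ (λ u v → u + v + f (2 ℕ.+ 2 ℕ.* m)) (∑≤-double m f odd≡0) (odd≡0 m) ⟩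
    ∑≤ m (f ∘ (2 ℕ.*_)) + 0# + f (2 ℕ.+ 2 ℕ.* m)              ≡⟨ cong₂ _+_ (+-identityʳ _) (cong f (sym (ℕ.*-suc 2 m))) ⟩
    ∑≤ (suc m) (f ∘ (2 ℕ.*_))                                 ∎

  ∑≤-evens : ∀ n (f : ℕ → A) → (∀ i → f (suc (2 ℕ.* i)) ≡ 0#) → ∑≤ n f ≡ ∑≤ (n / 2) (f ∘ (2 ℕ.*_))
  ∑≤-evens n f odd≡0 with n≡2*[n/2]⊎n≡1+2*[n/2] n
  ... | inj₁ even = trans (cong (λ m → ∑≤ m f) even) (∑≤-double (n / 2) f odd≡0)
  ... | inj₂ odd  = begin
    ∑≤ n f                                                ≡⟨ cong (λ m → ∑≤ m f) odd ⟩
    ∑≤ (2 ℕ.* (n / 2)) f + f (suc (2 ℕ.* (n / 2)))        ≡⟨ cong₂ _+_ (∑≤-double (n / 2) f odd≡0) (odd≡0 (n / 2)) ⟩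
    ∑≤ (n / 2) (f ∘ (2 ℕ.*_)) + 0#                        ≡⟨ +-identityʳ _ ⟩
    ∑≤ (n / 2) (f ∘ (2 ℕ.*_))                             ∎

  -- A sequence a stands for the exponential generating function Σ aₙ zⁿ/n!: ⊛ is the product,
  -- exp x is e^{xz}, scale x a is a(xz), shift a is a′(z), δ₀ is 1 and δ₁ is z.
  Seq : Set
  Seq = ℕ → A

  infixl 7 _⊛_
  infixl 6 _⊞_
  infixr 8 _⊙_

  _⊛_ : Seq → Seq → Seq
  (a ⊛ b) n = ∑≤ n λ k → (n C k) × (a k * b (n ∸ k))

  _⊞_ : Seq → Seq → Seq
  (a ⊞ b) k = a k + b k

  _⊙_ : A → Seq → Seq
  (c ⊙ a) k = c * a k

  shift : Seq → Seq
  shift a k = a (suc k)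

  exp : A → Seq
  exp x k = x ^ k

  scale : A → Seq → Seq
  scale x a k = x ^ k * a k

  δ₀ δ₁ : Seq
  δ₀ zero    = 1#
  δ₀ (suc _) = 0#
  δ₁ zero          = 0#
  δ₁ (suc zero)    = 1#
  δ₁ (suc (suc _)) = 0#

  ⊛-cong : ∀ {a a′ b b′} → a ≗ a′ → b ≗ b′ → a ⊛ b ≗ a′ ⊛ b′
  ⊛-cong a≗a′ b≗b′ n = ∑≤-cong n λ {k} _ → cong (λ x → (n C k) × x) (cong₂ _*_ (a≗a′ k) (b≗b′ (n ∸ k)))

  ⊛-leibniz : ∀ a b n → (a ⊛ b) (suc n) ≡ (shift a ⊛ b) n + (a ⊛ shift b) n
  ⊛-leibniz a b n = begin
    ∑≤ (suc n) g                                  ≡⟨ ∑≤-unfoldˡ n g ⟩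
    g 0 + ∑≤ n (g ∘ suc)                          ≡⟨ cong (g 0 +_) (trans (∑≤-cong n λ {k} _ → pascal k) (∑≤-+ n _ (h ∘ suc))) ⟩
    h 0 + ((shift a ⊛ b) n + ∑≤ n (h ∘ suc))      ≡⟨ x∙yz≈y∙xz (h 0) _ _ ⟩
    (shift a ⊛ b) n + (h 0 + ∑≤ n (h ∘ suc))      ≡⟨ cong ((shift a ⊛ b) n +_) (sym (∑≤-unfoldˡ n h)) ⟩
    (shift a ⊛ b) n + (∑≤ n h + h (suc n))        ≡⟨ cong ((shift a ⊛ b) n +_) (cong₂ _+_ (∑≤-cong n h≡) h-last) ⟩
    (shift a ⊛ b) n + ((a ⊛ shift b) n + 0#)      ≡⟨ cong ((shift a ⊛ b) n +_) (+-identityʳ _) ⟩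
    (shift a ⊛ b) n + (a ⊛ shift b) n             ∎
    where
    g h : ℕ → A
    g k = (suc n C k) × (a k * b (suc n ∸ k))
    h k = (n C k) × (a k * b (suc n ∸ k))
    pascal : ∀ k → g (suc k) ≡ (n C k) × (a (suc k) * b (n ∸ k)) + h (suc k)
    pascal k = trans (cong (_× (a (suc k) * b (n ∸ k))) (sym (nCk+nC[k+1]≡[n+1]C[k+1] n k)))
                     (×-homo-+ _ (n C k) (n C suc k))
    h≡ : ∀ {k} → k ≤ n → h k ≡ (n C k) × (a k * shift b (n ∸ k))
    h≡ {k} k≤n = cong (λ m → (n C k) × (a k * b m)) (ℕ.+-∸-assoc 1 k≤n)
    h-last : h (suc n) ≡ 0#
    h-last = trans (cong (_× (a (suc n) * b (n ∸ n))) (k>n⇒nCk≡0 (ℕ.n<1+n n))) (×-homo-0 (a (suc n) * b (n ∸ n)))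

  ⊛-distribʳ : ∀ a a′ b → (a ⊞ a′) ⊛ b ≗ a ⊛ b ⊞ a′ ⊛ b
  ⊛-distribʳ a a′ b n = trans (∑≤-cong n λ {k} _ → term k) (∑≤-+ n _ _)
    where
    term : ∀ k → (n C k) × ((a k + a′ k) * b (n ∸ k)) ≡ (n C k) × (a k * b (n ∸ k)) + (n C k) × (a′ k * b (n ∸ k))
    term k = trans (cong ((n C k) ×_) (distribʳ (b (n ∸ k)) (a k) (a′ k))) (×-distrib-+ _ _ (n C k))

  ⊛-distribˡ : ∀ a b b′ → a ⊛ (b ⊞ b′) ≗ a ⊛ b ⊞ a ⊛ b′
  ⊛-distribˡ a b b′ n = trans (∑≤-cong n λ {k} _ → term k) (∑≤-+ n _ _)
    where
    term : ∀ k → (n C k) × (a k * (b (n ∸ k) + b′ (n ∸ k))) ≡ (n C k) × (a k * b (n ∸ k)) + (n C k) × (a k * b′ (n ∸ k))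
    term k = trans (cong ((n C k) ×_) (distribˡ (a k) (b (n ∸ k)) (b′ (n ∸ k)))) (×-distrib-+ _ _ (n C k))

  ⊛-⊙ˡ : ∀ c a b → (c ⊙ a) ⊛ b ≗ c ⊙ (a ⊛ b)
  ⊛-⊙ˡ c a b n = trans (∑≤-cong n λ {k} _ → term k) (∑≤-*ˡ n c _)
    where
    term : ∀ k → (n C k) × (c * a k * b (n ∸ k)) ≡ c * (n C k) × (a k * b (n ∸ k))
    term k = trans (cong ((n C k) ×_) (*-assoc c (a k) (b (n ∸ k)))) (sym (×-comm-* (n C k) c _))

  ⊛-⊙ʳ : ∀ c a b → a ⊛ (c ⊙ b) ≗ c ⊙ (a ⊛ b)
  ⊛-⊙ʳ c a b n = trans (∑≤-cong n λ {k} _ → term k) (∑≤-*ˡ n c _)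
    where
    term : ∀ k → (n C k) × (a k * (c * b (n ∸ k))) ≡ c * (n C k) × (a k * b (n ∸ k))
    term k = trans (cong ((n C k) ×_) (*.x∙yz≈y∙xz (a k) c (b (n ∸ k)))) (sym (×-comm-* (n C k) c _))

  ⊛-comm : ∀ a b → a ⊛ b ≗ b ⊛ a
  ⊛-comm a b zero    = cong (1 ×_) (*-comm (a 0) (b 0))
  ⊛-comm a b (suc n) = begin
    (a ⊛ b) (suc n)                       ≡⟨ ⊛-leibniz a b n ⟩
    (shift a ⊛ b) n + (a ⊛ shift b) n     ≡⟨ cong₂ _+_ (⊛-comm (shift a) b n) (⊛-comm a (shift b) n) ⟩
    (b ⊛ shift a) n + (shift b ⊛ a) n     ≡⟨ +-comm _ _ ⟩
    (shift b ⊛ a) n + (b ⊛ shift a) n     ≡⟨ ⊛-leibniz b a n ⟨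
    (b ⊛ a) (suc n)                       ∎

  ⊛-assoc : ∀ a b c → (a ⊛ b) ⊛ c ≗ a ⊛ (b ⊛ c)
  ⊛-assoc a b c zero    = cong (1 ×_) (trans (cong (_* c 0) (×-homo-1 (a 0 * b 0)))
                                        (trans (*-assoc (a 0) (b 0) (c 0)) (cong (a 0 *_) (sym (×-homo-1 (b 0 * c 0))))))
  ⊛-assoc a b c (suc n) = begin
    ((a ⊛ b) ⊛ c) (suc n)
      ≡⟨ ⊛-leibniz (a ⊛ b) c n ⟩
    (shift (a ⊛ b) ⊛ c) n + ((a ⊛ b) ⊛ shift c) n
      ≡⟨ cong (_+ ((a ⊛ b) ⊛ shift c) n) (trans (⊛-cong {b = c} (⊛-leibniz a b) (λ _ → refl) n) (⊛-distribʳ (shift a ⊛ b) (a ⊛ shift b) c n)) ⟩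
    ((shift a ⊛ b) ⊛ c) n + ((a ⊛ shift b) ⊛ c) n + ((a ⊛ b) ⊛ shift c) n
      ≡⟨ cong₂ _+_ (cong₂ _+_ (⊛-assoc (shift a) b c n) (⊛-assoc a (shift b) c n)) (⊛-assoc a b (shift c) n) ⟩
    (shift a ⊛ (b ⊛ c)) n + (a ⊛ (shift b ⊛ c)) n + (a ⊛ (b ⊛ shift c)) n
      ≡⟨ +-assoc _ _ _ ⟩
    (shift a ⊛ (b ⊛ c)) n + ((a ⊛ (shift b ⊛ c)) n + (a ⊛ (b ⊛ shift c)) n)
      ≡⟨ cong ((shift a ⊛ (b ⊛ c)) n +_) (trans (sym (⊛-distribˡ a (shift b ⊛ c) (b ⊛ shift c) n)) (⊛-cong {a = a} (λ _ → refl) (sym ∘ ⊛-leibniz b c) n)) ⟩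
    (shift a ⊛ (b ⊛ c)) n + (a ⊛ shift (b ⊛ c)) n
      ≡⟨ ⊛-leibniz a (b ⊛ c) n ⟨
    (a ⊛ (b ⊛ c)) (suc n) ∎

  ⊛-swap : ∀ a b c → a ⊛ (b ⊛ c) ≗ b ⊛ (a ⊛ c)
  ⊛-swap a b c n = begin
    (a ⊛ (b ⊛ c)) n      ≡⟨ ⊛-assoc a b c n ⟨
    ((a ⊛ b) ⊛ c) n      ≡⟨ ⊛-cong {b = c} (⊛-comm a b) (λ _ → refl) n ⟩
    ((b ⊛ a) ⊛ c) n      ≡⟨ ⊛-assoc b a c n ⟩
    (b ⊛ (a ⊛ c)) n      ∎

  ⊛-zeroˡ : ∀ a → (λ _ → 0#) ⊛ a ≗ λ _ → 0#
  ⊛-zeroˡ a n = ∑≤-zero n λ {k} _ → trans (cong ((n C k) ×_) (zeroˡ (a (n ∸ k)))) (×-zeroʳ (n C k))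

  ⊛-identityˡ : ∀ a → δ₀ ⊛ a ≗ a
  ⊛-identityˡ a zero    = trans (×-homo-1 (1# * a 0)) (*-identityˡ (a 0))
  ⊛-identityˡ a (suc n) = begin
    (δ₀ ⊛ a) (suc n)                        ≡⟨ ⊛-leibniz δ₀ a n ⟩
    (shift δ₀ ⊛ a) n + (δ₀ ⊛ shift a) n     ≡⟨ cong₂ _+_ (⊛-zeroˡ a n) (⊛-identityˡ (shift a) n) ⟩
    0# + a (suc n)                          ≡⟨ +-identityˡ (a (suc n)) ⟩
    a (suc n)                               ∎

  ⊛-identityʳ : ∀ a → a ⊛ δ₀ ≗ a
  ⊛-identityʳ a n = trans (⊛-comm a δ₀ n) (⊛-identityˡ a n)

  δ₁-⊛ : ∀ a n → (δ₁ ⊛ a) n ≡ n × a (n ∸ 1)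
  δ₁-⊛ a zero    = trans (×-homo-1 (0# * a 0)) (zeroˡ (a 0))
  δ₁-⊛ a (suc n) = begin
    (δ₁ ⊛ a) (suc n)                        ≡⟨ ⊛-leibniz δ₁ a n ⟩
    (shift δ₁ ⊛ a) n + (δ₁ ⊛ shift a) n     ≡⟨ cong₂ _+_ (⊛-cong {b = a} shift-δ₁ (λ _ → refl) n) (δ₁-⊛ (shift a) n) ⟩
    (δ₀ ⊛ a) n + n × a (suc (n ∸ 1))        ≡⟨ cong₂ _+_ (⊛-identityˡ a n) (pred-index n) ⟩
    a n + n × a n                           ∎
    where
    shift-δ₁ : shift δ₁ ≗ δ₀
    shift-δ₁ zero    = refl
    shift-δ₁ (suc _) = refl
    pred-index : ∀ n → n × a (suc (n ∸ 1)) ≡ n × a n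
    pred-index zero    = refl
    pred-index (suc _) = refl

  exp-⊛-exp : ∀ x y → exp x ⊛ exp y ≗ exp (x + y)
  exp-⊛-exp x y zero    = trans (×-homo-1 (1# * 1#)) (*-identityˡ 1#)
  exp-⊛-exp x y (suc n) = begin
    (exp x ⊛ exp y) (suc n)                                     ≡⟨ ⊛-leibniz (exp x) (exp y) n ⟩
    ((x ⊙ exp x) ⊛ exp y) n + (exp x ⊛ (y ⊙ exp y)) n           ≡⟨ cong₂ _+_ (⊛-⊙ˡ x (exp x) (exp y) n) (⊛-⊙ʳ y (exp x) (exp y) n) ⟩
    x * (exp x ⊛ exp y) n + y * (exp x ⊛ exp y) n               ≡⟨ distribʳ _ x y ⟨
    (x + y) * (exp x ⊛ exp y) n                                 ≡⟨ cong ((x + y) *_) (exp-⊛-exp x y n) ⟩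
    (x + y) ^ suc n                                             ∎

  exp-0 : exp 0# ≗ δ₀
  exp-0 zero    = refl
  exp-0 (suc k) = zeroˡ (0# ^ k)

  shift-scale : ∀ x a → shift (scale x a) ≗ x ⊙ scale x (shift a)
  shift-scale x a k = *-assoc x (x ^ k) (a (suc k))

  scale-⊛ : ∀ x a b → scale x (a ⊛ b) ≗ scale x a ⊛ scale x b
  scale-⊛ x a b zero    = begin
    1# * 1 × (a 0 * b 0)                ≡⟨ *-identityˡ _ ⟩
    1 × (a 0 * b 0)                     ≡⟨ cong (λ u → 1 × (u * b 0)) (*-identityˡ (a 0)) ⟨
    1 × (1# * a 0 * b 0)                ≡⟨ cong (λ u → 1 × (1# * a 0 * u)) (*-identityˡ (b 0)) ⟨
    1 × (1# * a 0 * (1# * b 0))         ∎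
  scale-⊛ x a b (suc n) = begin
    x * x ^ n * (a ⊛ b) (suc n)
      ≡⟨ *-assoc x (x ^ n) _ ⟩
    x * (x ^ n * (a ⊛ b) (suc n))
      ≡⟨ cong (λ u → x * (x ^ n * u)) (⊛-leibniz a b n) ⟩
    x * (x ^ n * ((shift a ⊛ b) n + (a ⊛ shift b) n))
      ≡⟨ cong (x *_) (distribˡ (x ^ n) _ _) ⟩
    x * (scale x (shift a ⊛ b) n + scale x (a ⊛ shift b) n)
      ≡⟨ cong (x *_) (cong₂ _+_ (scale-⊛ x (shift a) b n) (scale-⊛ x a (shift b) n)) ⟩
    x * ((scale x (shift a) ⊛ scale x b) n + (scale x a ⊛ scale x (shift b)) n)
      ≡⟨ distribˡ x _ _ ⟩
    x * (scale x (shift a) ⊛ scale x b) n + x * (scale x a ⊛ scale x (shift b)) n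
      ≡⟨ cong₂ _+_ (⊛-⊙ˡ x (scale x (shift a)) (scale x b) n) (⊛-⊙ʳ x (scale x a) (scale x (shift b)) n) ⟨
    ((x ⊙ scale x (shift a)) ⊛ scale x b) n + (scale x a ⊛ (x ⊙ scale x (shift b))) n
      ≡⟨ cong₂ _+_ (⊛-cong {b = scale x b} (sym ∘ shift-scale x a) (λ _ → refl) n)
                   (⊛-cong {a = scale x a} (λ _ → refl) (sym ∘ shift-scale x b) n) ⟩
    (shift (scale x a) ⊛ scale x b) n + (scale x a ⊛ shift (scale x b)) n
      ≡⟨ ⊛-leibniz (scale x a) (scale x b) n ⟨
    (scale x a ⊛ scale x b) (suc n) ∎

  scale-exp1 : ∀ x → scale x (exp 1#) ≗ exp x
  scale-exp1 x k = trans (cong (x ^ k *_) (1^n≡1 k)) (*-identityʳ (x ^ k))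

  scale-δ₁ : ∀ x → scale x δ₁ ≗ x ⊙ δ₁
  scale-δ₁ x zero          = trans (zeroʳ 1#) (sym (zeroʳ x))
  scale-δ₁ x (suc zero)    = cong (_* 1#) (*-identityʳ x)
  scale-δ₁ x (suc (suc n)) = trans (zeroʳ _) (sym (zeroʳ x))

  scale-⊞ : ∀ x a b → scale x (a ⊞ b) ≗ scale x a ⊞ scale x b
  scale-⊞ x a b k = distribˡ (x ^ k) (a k) (b k)

  scale-⊙ : ∀ x c a → scale x (c ⊙ a) ≗ c ⊙ scale x a
  scale-⊙ x c a k = *.x∙yz≈y∙xz (x ^ k) c (a k)

  TorsionFree : Set
  TorsionFree = ∀ n x → suc n × x ≡ 0# → x ≡ 0#

  ⊛-exp1-fixed⇒0 : TorsionFree → ∀ a → a ⊛ exp 1# ≗ a → a ≗ λ _ → 0#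
  ⊛-exp1-fixed⇒0 torsionFree a fixed = <-rec _ step
    where
    -- Once a vanishes below m, coefficient m + 1 of a ⊛ exp 1# is (m + 1) × a m + a (m + 1).
    step : ∀ m → (∀ {k} → k < m → a k ≡ 0#) → a m ≡ 0#
    step m ih = torsionFree m (a m) (identityˡ-unique _ (a (suc m)) (begin
      suc m × a m + a (suc m)                     ≡⟨ cong₂ _+_ (sym (term-m)) (sym term-last) ⟩
      f m + f (suc m)                             ≡⟨ cong (_+ f (suc m)) (∑≤-lastOnly m (λ k<m → term-below k<m)) ⟨
      (a ⊛ exp 1#) (suc m)                        ≡⟨ fixed (suc m) ⟩
      a (suc m)                                   ∎))
      where
      f : ℕ → A
      f k = (suc m C k) × (a k * 1# ^ (suc m ∸ k))
      term-below : ∀ {k} → k < m → f k ≡ 0#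
      term-below {k} k<m = trans (cong (λ x → (suc m C k) × (x * _)) (ih k<m))
                                 (trans (cong ((suc m C k) ×_) (zeroˡ _)) (×-zeroʳ (suc m C k)))
      term-m : f m ≡ suc m × a m
      term-m = cong₂ _×_ ([1+n]Cn≡1+n m) (trans (cong (a m *_) (1^n≡1 (suc m ∸ m))) (*-identityʳ (a m)))
      term-last : f (suc m) ≡ a (suc m)
      term-last = trans (cong₂ _×_ (nCn≡1 (suc m)) (trans (cong (a (suc m) *_) (1^n≡1 (m ∸ m))) (*-identityʳ _)))
                        (×-homo-1 (a (suc m)))

  ⊛-exp1-cancel : TorsionFree → ∀ a a′ b → a ⊛ exp 1# ≗ a ⊞ b → a′ ⊛ exp 1# ≗ a′ ⊞ b → a ≗ a′
  ⊛-exp1-cancel torsionFree a a′ b a-eq a′-eq n =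
    x∙y⁻¹≈ε⇒x≈y (a n) (a′ n) (trans (sym (d≡a-a′ n)) (⊛-exp1-fixed⇒0 torsionFree d d-fixed n))
    where
    d : Seq
    d = a ⊞ (- 1#) ⊙ a′
    d≡a-a′ : ∀ k → d k ≡ a k - a′ k
    d≡a-a′ k = cong (a k +_) (-1*x≈-x (a′ k))
    d-fixed : d ⊛ exp 1# ≗ d
    d-fixed k = begin
      (d ⊛ exp 1#) k                                  ≡⟨ ⊛-distribʳ a ((- 1#) ⊙ a′) (exp 1#) k ⟩
      (a ⊛ exp 1#) k + ((- 1#) ⊙ a′ ⊛ exp 1#) k       ≡⟨ cong ((a ⊛ exp 1#) k +_) (trans (⊛-⊙ˡ (- 1#) a′ (exp 1#) k) (-1*x≈-x _)) ⟩
      (a ⊛ exp 1#) k - (a′ ⊛ exp 1#) k                ≡⟨ cong₂ _-_ (a-eq k) (a′-eq k) ⟩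
      (a k + b k) - (a′ k + b k)                      ≡⟨ cong ((a k + b k) +_) (⁻¹-∙-comm (a′ k) (b k)) ⟨
      (a k + b k) + (- a′ k - b k)                    ≡⟨ interchange (a k) (b k) (- a′ k) (- b k) ⟩
      (a k - a′ k) + (b k - b k)                      ≡⟨ cong ((a k - a′ k) +_) (-‿inverseʳ (b k)) ⟩
      (a k - a′ k) + 0#                               ≡⟨ +-identityʳ _ ⟩
      a k - a′ k                                      ≡⟨ d≡a-a′ k ⟨
      d k                                             ∎

  module _ (a : Seq) (c : A)
    (functionalEquation : a ⊛ exp 1# ⊞ a ≗ c ⊙ (δ₁ ⊛ exp 1#) ⊞ (- c) ⊙ δ₁)
    where

    scaled-functionalEquation : ∀ d → scale d a ⊛ exp d ⊞ scale d a ≗ (c * d) ⊙ (δ₁ ⊛ exp d) ⊞ (- c * d) ⊙ δ₁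
    scaled-functionalEquation d k = begin
      (scale d a ⊛ exp d) k + d ^ k * a k
        ≡⟨ cong (_+ d ^ k * a k) (trans (⊛-cong {a = scale d a} (λ _ → refl) (sym ∘ scale-exp1 d) k) (sym (scale-⊛ d a (exp 1#) k))) ⟩
      d ^ k * (a ⊛ exp 1#) k + d ^ k * a k
        ≡⟨ distribˡ (d ^ k) _ _ ⟨
      d ^ k * ((a ⊛ exp 1#) k + a k)
        ≡⟨ cong (d ^ k *_) (functionalEquation k) ⟩
      d ^ k * (c * (δ₁ ⊛ exp 1#) k + - c * δ₁ k)
        ≡⟨ trans (distribˡ (d ^ k) _ _) (cong₂ _+_ (*.x∙yz≈y∙xz (d ^ k) c _) (*.x∙yz≈y∙xz (d ^ k) (- c) _)) ⟩
      c * scale d (δ₁ ⊛ exp 1#) k + - c * scale d δ₁ k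
        ≡⟨ cong₂ (λ u v → c * u + - c * v) (scale-⊛ d δ₁ (exp 1#) k) (scale-δ₁ d k) ⟩
      c * (scale d δ₁ ⊛ scale d (exp 1#)) k + - c * (d * δ₁ k)
        ≡⟨ cong (λ u → c * u + - c * (d * δ₁ k)) (trans (⊛-cong (scale-δ₁ d) (scale-exp1 d) k) (⊛-⊙ˡ d δ₁ (exp d) k)) ⟩
      c * (d * (δ₁ ⊛ exp d) k) + - c * (d * δ₁ k)
        ≡⟨ cong₂ _+_ (*-assoc c d _) (*-assoc (- c) d _) ⟨
      c * d * (δ₁ ⊛ exp d) k + - c * d * δ₁ k
        ∎

    scale-⊛-exp-sum : ∀ β d n → (scale d a ⊛ (exp (β + d) ⊞ exp β)) n ≡
                      c * d * n × (β + d) ^ (n ∸ 1) + - c * d * n × β ^ (n ∸ 1)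
    scale-⊛-exp-sum β d n = begin
      (scale d a ⊛ (exp (β + d) ⊞ exp β)) n
        ≡⟨ ⊛-distribˡ (scale d a) (exp (β + d)) (exp β) n ⟩
      (scale d a ⊛ exp (β + d)) n + (scale d a ⊛ exp β) n
        ≡⟨ cong₂ _+_ (trans (⊛-cong {a = scale d a} (λ _ → refl) (sym ∘ exp-⊛-exp β d) n) (⊛-swap (scale d a) (exp β) (exp d) n))
                     (⊛-comm (scale d a) (exp β) n) ⟩
      (exp β ⊛ (scale d a ⊛ exp d)) n + (exp β ⊛ scale d a) n
        ≡⟨ ⊛-distribˡ (exp β) (scale d a ⊛ exp d) (scale d a) n ⟨
      (exp β ⊛ (scale d a ⊛ exp d ⊞ scale d a)) n
        ≡⟨ ⊛-cong {a = exp β} (λ _ → refl) (scaled-functionalEquation d) n ⟩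
      (exp β ⊛ ((c * d) ⊙ (δ₁ ⊛ exp d) ⊞ (- c * d) ⊙ δ₁)) n
        ≡⟨ ⊛-distribˡ (exp β) ((c * d) ⊙ (δ₁ ⊛ exp d)) ((- c * d) ⊙ δ₁) n ⟩
      (exp β ⊛ ((c * d) ⊙ (δ₁ ⊛ exp d))) n + (exp β ⊛ ((- c * d) ⊙ δ₁)) n
        ≡⟨ cong₂ _+_ (⊛-⊙ʳ (c * d) (exp β) (δ₁ ⊛ exp d) n) (⊛-⊙ʳ (- c * d) (exp β) δ₁ n) ⟩
      c * d * (exp β ⊛ (δ₁ ⊛ exp d)) n + - c * d * (exp β ⊛ δ₁) n
        ≡⟨ cong₂ (λ u v → c * d * u + - c * d * v) e^βz·z·e^dz e^βz·z ⟩
      c * d * n × (β + d) ^ (n ∸ 1) + - c * d * n × β ^ (n ∸ 1)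
        ∎
      where
      e^βz·z·e^dz : (exp β ⊛ (δ₁ ⊛ exp d)) n ≡ n × (β + d) ^ (n ∸ 1)
      e^βz·z·e^dz = begin
        (exp β ⊛ (δ₁ ⊛ exp d)) n   ≡⟨ ⊛-swap (exp β) δ₁ (exp d) n ⟩
        (δ₁ ⊛ (exp β ⊛ exp d)) n   ≡⟨ ⊛-cong {a = δ₁} (λ _ → refl) (exp-⊛-exp β d) n ⟩
        (δ₁ ⊛ exp (β + d)) n       ≡⟨ δ₁-⊛ (exp (β + d)) n ⟩
        n × (β + d) ^ (n ∸ 1)      ∎
      e^βz·z : (exp β ⊛ δ₁) n ≡ n × β ^ (n ∸ 1)
      e^βz·z = trans (⊛-comm (exp β) δ₁ n) (δ₁-⊛ (exp β) n)

ℚ-almostCommutativeRing : ACR.AlmostCommutativeRing 0ℓ 0ℓ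
ℚ-almostCommutativeRing = ACR.fromCommutativeRing ℚ.+-*-commutativeRing (λ x → dec⇒maybe (0ℚ ℚ.≟ x))

ℕ→ℚ≡mkℚ : ∀ n → ℕ→ℚ n ≡ mkℚ (ℤ.+ n) 0 (Coprime.sym (Coprime.1-coprimeTo n))
ℕ→ℚ≡mkℚ n = ℚ.normalize-coprime (Coprime.sym (Coprime.1-coprimeTo n))

ℕ→ℚ-+ : ∀ m n → ℕ→ℚ (m ℕ.+ n) ≡ ℕ→ℚ m ℚ.+ ℕ→ℚ n
ℕ→ℚ-+ m n = sym (trans (cong₂ ℚ._+_ (ℕ→ℚ≡mkℚ m) (ℕ→ℚ≡mkℚ n))
  (ℚ./-cong {p₁ = ℤ.+ m ℤ.* ℤ.+ 1 ℤ.+ ℤ.+ n ℤ.* ℤ.+ 1} (cong₂ ℤ._+_ (ℤ.*-identityʳ (ℤ.+ m)) (ℤ.*-identityʳ (ℤ.+ n))) refl))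

ℕ→ℚ-* : ∀ m n → ℕ→ℚ (m ℕ.* n) ≡ ℕ→ℚ m ℚ.* ℕ→ℚ n
ℕ→ℚ-* m n = sym (trans (cong₂ ℚ._*_ (ℕ→ℚ≡mkℚ m) (ℕ→ℚ≡mkℚ n))
  (ℚ./-cong {p₁ = ℤ.+ m ℤ.* ℤ.+ n} (sym (ℤ.pos-* m n)) refl))

ℕ→ℚ-∸ : ∀ m n → n ≤ m → ℕ→ℚ (m ∸ n) ≡ ℕ→ℚ m ℚ.- ℕ→ℚ n
ℕ→ℚ-∸ m n n≤m = begin
  ℕ→ℚ (m ∸ n)                                ≡⟨ x≡x+y-y (ℕ→ℚ (m ∸ n)) (ℕ→ℚ n) ⟩
  (ℕ→ℚ (m ∸ n) ℚ.+ ℕ→ℚ n) ℚ.- ℕ→ℚ n          ≡⟨ cong (ℚ._- ℕ→ℚ n) (trans (sym (ℕ→ℚ-+ (m ∸ n) n)) (cong ℕ→ℚ (ℕ.m∸n+n≡m n≤m))) ⟩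
  ℕ→ℚ m ℚ.- ℕ→ℚ n                            ∎
  where
  open ≡-Reasoning
  x≡x+y-y : ∀ x y → x ≡ (x ℚ.+ y) ℚ.- y
  x≡x+y-y = solve-∀ ℚ-almostCommutativeRing

[+m]/2≡m*½ : ∀ m → ℤ.+ m ℚ./ 2 ≡ ℕ→ℚ m ℚ.* ½
[+m]/2≡m*½ m = sym (trans (cong (ℚ._* ½) (ℕ→ℚ≡mkℚ m)) (ℚ./-cong {p₁ = ℤ.+ m ℤ.* ℤ.+ 1} {q₁ = 2} (ℤ.*-identityʳ (ℤ.+ m)) refl))

sumTo-cong : ∀ n {f g : ℕ → ℚ} → (∀ {k} → k ≤ n → f k ≡ g k) → sumTo n f ≡ sumTo n g
sumTo-cong zero    f≗g = f≗g z≤n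
sumTo-cong (suc n) f≗g = cong₂ ℚ._+_ (sumTo-cong n (λ k≤n → f≗g (ℕ.m≤n⇒m≤1+n k≤n))) (f≗g ℕ.≤-refl)

module ℚSeries = ExponentialSeries ℚ.+-*-isCommutativeRing

ℕ→ℚ-^ : ∀ m k → ℕ→ℚ (m ℕ.^ k) ≡ ℕ→ℚ m ℚSeries.^ k
ℕ→ℚ-^ m zero    = refl
ℕ→ℚ-^ m (suc k) = trans (ℕ→ℚ-* m (m ℕ.^ k)) (cong (ℕ→ℚ m ℚ.*_) (ℕ→ℚ-^ m k))

×≡ℕ→ℚ* : ∀ n q → n ℚSeries.× q ≡ ℕ→ℚ n ℚ.* q
×≡ℕ→ℚ* zero    q = sym (ℚ.*-zeroˡ q)
×≡ℕ→ℚ* (suc n) q = begin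
  q ℚ.+ n ℚSeries.× q           ≡⟨ cong (q ℚ.+_) (×≡ℕ→ℚ* n q) ⟩
  q ℚ.+ ℕ→ℚ n ℚ.* q              ≡⟨ cong (ℚ._+ ℕ→ℚ n ℚ.* q) (ℚ.*-identityˡ q) ⟨
  1ℚ ℚ.* q ℚ.+ ℕ→ℚ n ℚ.* q       ≡⟨ ℚ.*-distribʳ-+ q 1ℚ (ℕ→ℚ n) ⟨
  (1ℚ ℚ.+ ℕ→ℚ n) ℚ.* q           ≡⟨ cong (ℚ._* q) (ℕ→ℚ-+ 1 n) ⟨
  ℕ→ℚ (suc n) ℚ.* q              ∎
  where open ≡-Reasoning

ℚ-torsionFree : ℚSeries.TorsionFree
ℚ-torsionFree n q n×q≡0 = begin
  q                                ≡⟨ ℚ.*-identityˡ q ⟨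
  1ℚ ℚ.* q                         ≡⟨ cong (ℚ._* q) (ℚ.*-inverseˡ p) ⟨
  ℚ.1/ p ℚ.* p ℚ.* q               ≡⟨ ℚ.*-assoc (ℚ.1/ p) p q ⟩
  ℚ.1/ p ℚ.* (p ℚ.* q)             ≡⟨ cong (λ r → ℚ.1/ p ℚ.* (r ℚ.* q)) (ℕ→ℚ≡mkℚ (suc n)) ⟨
  ℚ.1/ p ℚ.* (ℕ→ℚ (suc n) ℚ.* q)  ≡⟨ cong (ℚ.1/ p ℚ.*_) (trans (sym (×≡ℕ→ℚ* (suc n) q)) n×q≡0) ⟩
  ℚ.1/ p ℚ.* 0ℚ                    ≡⟨ ℚ.*-zeroʳ (ℚ.1/ p) ⟩
  0ℚ                               ∎
  where
  open ≡-Reasoning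
  p : ℚ
  p = mkℚ (ℤ.+ suc n) 0 (Coprime.sym (Coprime.1-coprimeTo (suc n)))

sumTo≡∑≤ : ∀ n f → sumTo n f ≡ ℚSeries.∑≤ n f
sumTo≡∑≤ zero    f = refl
sumTo≡∑≤ (suc n) f = cong (ℚ._+ f (suc n)) (sumTo≡∑≤ n f)

module Bernoulli where

  open ℚSeries using (Seq; _×_; _⊛_; _⊞_; _⊙_; exp; scale; δ₀; δ₁)
  open import Algebra.Properties.Semiring.Exp (CommutativeRing.semiring ℚ.+-*-commutativeRing) using (^-assocʳ)

  lookup-∷ʳ-fromℕ : ∀ {A : Set} {n} (xs : Vec A n) x → lookup (xs ∷ʳ x) (fromℕ n) ≡ x
  lookup-∷ʳ-fromℕ []       x = refl
  lookup-∷ʳ-fromℕ (_ ∷ xs) x = lookup-∷ʳ-fromℕ xs x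

  lookup-∷ʳ-fromℕ< : ∀ {A : Set} {n} (xs : Vec A n) x {k} (k<n : k < n) (k<1+n : k < suc n) →
                     lookup (xs ∷ʳ x) (fromℕ< k<1+n) ≡ lookup xs (fromℕ< k<n)
  lookup-∷ʳ-fromℕ< (_ ∷ xs) x {zero}  _         _           = refl
  lookup-∷ʳ-fromℕ< (_ ∷ xs) x {suc k} (s≤s k<n) (s≤s k<1+n) = lookup-∷ʳ-fromℕ< xs x k<n k<1+n

  bernVec-lookup : ∀ n {k} (k<1+n : k < suc n) → lookup (bernVec n) (fromℕ< k<1+n) ≡ B k
  bernVec-lookup zero    {zero}  _             = refl
  bernVec-lookup zero    {suc _} (s≤s ())
  bernVec-lookup (suc n) {k} k<2+n with k ℕ.≤? n
  ... | yes k≤n = trans (lookup-∷ʳ-fromℕ< (bernVec n) _ (s≤s k≤n) k<2+n) (bernVec-lookup n (s≤s k≤n))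
  ... | no  k≰n with ℕ.≤-antisym (ℕ.≤-pred k<2+n) (ℕ.≰⇒> k≰n)
  ...   | refl = cong (lookup (bernVec (suc n))) (trans (Fin.fromℕ<-cong _ _ refl k<2+n ℕ.≤-refl) (sym (Fin.fromℕ-def (suc n))))

  -- The summand of the recursive clause of bernVec is local to it, so it is obtained by unification.
  B-suc-unfold : ∀ n → Σ (ℕ → ℚ) λ summand → B (suc n) ≡ ℚ.- ((ℤ.+ 1 ℚ./ suc (suc n)) ℚ.* sumTo n summand)
  B-suc-unfold n = _ , lookup-∷ʳ-fromℕ (bernVec n) _

  B-suc-summand : ∀ n {k} → k ≤ n → proj₁ (B-suc-unfold n) k ≡ ℕ→ℚ ((n ℕ.+ 2) C k) ℚ.* B k
  B-suc-summand n {k} k≤n with k ℕ.≤? n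
  ... | yes k≤n′ = cong (ℕ→ℚ ((n ℕ.+ 2) C k) ℚ.*_) (bernVec-lookup n (s≤s k≤n′))
  ... | no  k≰n  = contradiction k≤n k≰n

  B-suc : ∀ n → B (suc n) ≡ ℚ.- ((ℤ.+ 1 ℚ./ suc (suc n)) ℚ.* sumTo n (λ k → ℕ→ℚ ((n ℕ.+ 2) C k) ℚ.* B k))
  B-suc n = trans (proj₂ (B-suc-unfold n)) (cong (λ s → ℚ.- ((ℤ.+ 1 ℚ./ suc (suc n)) ℚ.* s)) (sumTo-cong n (B-suc-summand n)))

  B-recurrence : ∀ m → sumTo (suc m) (λ k → ℕ→ℚ ((m ℕ.+ 2) C k) ℚ.* B k) ≡ 0ℚ
  B-recurrence m = begin
    S ℚ.+ ℕ→ℚ ((m ℕ.+ 2) C suc m) ℚ.* B (suc m)    ≡⟨ cong₂ (λ c b → S ℚ.+ ℕ→ℚ c ℚ.* b) (trans (cong (_C suc m) (ℕ.+-comm m 2)) ([1+n]Cn≡1+n (suc m))) (B-suc m) ⟩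
    S ℚ.+ q ℚ.* ℚ.- (q⁻¹ ℚ.* S)                    ≡⟨ cancel S q q⁻¹ ⟩
    S ℚ.- q⁻¹ ℚ.* q ℚ.* S                          ≡⟨ cong (λ r → S ℚ.- r ℚ.* S) inverse ⟩
    S ℚ.- 1ℚ ℚ.* S                                 ≡⟨ x-1x≡0 S ⟩
    0ℚ                                             ∎
    where
    open ≡-Reasoning
    S q q⁻¹ : ℚ
    S   = sumTo m (λ k → ℕ→ℚ ((m ℕ.+ 2) C k) ℚ.* B k)
    q   = ℕ→ℚ (suc (suc m))
    q⁻¹ = ℤ.+ 1 ℚ./ suc (suc m)
    inverse : q⁻¹ ℚ.* q ≡ 1ℚ
    inverse = trans (cong₂ ℚ._*_ (ℚ.normalize-coprime (Coprime.1-coprimeTo (suc (suc m)))) (ℕ→ℚ≡mkℚ (suc (suc m))))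
                    (ℚ.*-inverseˡ (mkℚ (ℤ.+ suc (suc m)) 0 (Coprime.sym (Coprime.1-coprimeTo (suc (suc m))))))
    cancel : ∀ S q q⁻¹ → S ℚ.+ q ℚ.* ℚ.- (q⁻¹ ℚ.* S) ≡ S ℚ.- q⁻¹ ℚ.* q ℚ.* S
    cancel = solve-∀ ℚ-almostCommutativeRing
    x-1x≡0 : ∀ x → x ℚ.- 1ℚ ℚ.* x ≡ 0ℚ
    x-1x≡0 = solve-∀ ℚ-almostCommutativeRing

  bernoulli-⊛-exp : B ⊛ exp 1ℚ ≗ B ⊞ δ₁
  bernoulli-⊛-exp n = trans (sym (trans (sumTo≡∑≤ n _) (ℚSeries.∑≤-cong n (λ {k} _ → summand k)))) (binomialSum n)
    where
    summand : ∀ k → ℕ→ℚ (n C k) ℚ.* B k ≡ (n C k) × (B k ℚ.* 1ℚ ℚSeries.^ (n ∸ k))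
    summand k = sym (trans (cong ((n C k) ×_) (trans (cong (B k ℚ.*_) (ℚSeries.1^n≡1 (n ∸ k))) (ℚ.*-identityʳ (B k))))
                           (×≡ℕ→ℚ* (n C k) (B k)))
    binomialSum : ∀ n → sumTo n (λ k → ℕ→ℚ (n C k) ℚ.* B k) ≡ B n ℚ.+ δ₁ n
    binomialSum zero          = refl
    binomialSum (suc zero)    = refl
    binomialSum (suc (suc m)) = begin
      sumTo (suc m) f ℚ.+ ℕ→ℚ (suc (suc m) C suc (suc m)) ℚ.* B (suc (suc m))
        ≡⟨ cong₂ (λ s c → s ℚ.+ ℕ→ℚ c ℚ.* B (suc (suc m))) (trans (cong (λ n → sumTo (suc m) λ k → ℕ→ℚ (n C k) ℚ.* B k) (ℕ.+-comm 2 m)) (B-recurrence m)) (nCn≡1 (suc (suc m))) ⟩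
      0ℚ ℚ.+ 1ℚ ℚ.* B (suc (suc m))
        ≡⟨ trans (ℚ.+-identityˡ _) (ℚ.*-identityˡ _) ⟩
      B (suc (suc m))
        ≡⟨ ℚ.+-identityʳ _ ⟨
      B (suc (suc m)) ℚ.+ 0ℚ ∎
      where
      open ≡-Reasoning
      f : ℕ → ℚ
      f k = ℕ→ℚ (suc (suc m) C k) ℚ.* B k

  two : ℚ
  two = 1ℚ ℚ.+ 1ℚ

  -- B₂(z) = B(2z), G(z) = B(2z) − B(z) = −z/(eᶻ + 1) and G⁻(z) = G(−z).
  B₂ : Seq
  B₂ = scale two B

  B₂-⊛-exp-two : B₂ ⊛ exp two ≗ B₂ ⊞ two ⊙ δ₁
  B₂-⊛-exp-two n = begin
    (B₂ ⊛ exp two) n                     ≡⟨ ℚSeries.⊛-cong {a = B₂} (λ _ → refl) (sym ∘ ℚSeries.scale-exp1 two) n ⟩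
    (B₂ ⊛ scale two (exp 1ℚ)) n          ≡⟨ ℚSeries.scale-⊛ two B (exp 1ℚ) n ⟨
    scale two (B ⊛ exp 1ℚ) n             ≡⟨ cong (two ℚSeries.^ n ℚ.*_) (bernoulli-⊛-exp n) ⟩
    scale two (B ⊞ δ₁) n                 ≡⟨ ℚSeries.scale-⊞ two B δ₁ n ⟩
    B₂ n ℚ.+ scale two δ₁ n              ≡⟨ cong (B₂ n ℚ.+_) (ℚSeries.scale-δ₁ two n) ⟩
    B₂ n ℚ.+ two ℚ.* δ₁ n                ∎
    where open ≡-Reasoning

  bernoulli-duplication : B₂ ⊛ exp 1ℚ ⊞ B₂ ≗ two ⊙ B
  bernoulli-duplication = ℚSeries.⊛-exp1-cancel ℚ-torsionFree _ _ (two ⊙ δ₁) lhs rhs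
    where
    open ≡-Reasoning
    lhs : (B₂ ⊛ exp 1ℚ ⊞ B₂) ⊛ exp 1ℚ ≗ (B₂ ⊛ exp 1ℚ ⊞ B₂) ⊞ two ⊙ δ₁
    lhs n = begin
      ((B₂ ⊛ exp 1ℚ ⊞ B₂) ⊛ exp 1ℚ) n
        ≡⟨ ℚSeries.⊛-distribʳ (B₂ ⊛ exp 1ℚ) B₂ (exp 1ℚ) n ⟩
      ((B₂ ⊛ exp 1ℚ) ⊛ exp 1ℚ) n ℚ.+ (B₂ ⊛ exp 1ℚ) n
        ≡⟨ cong (ℚ._+ (B₂ ⊛ exp 1ℚ) n) (trans (ℚSeries.⊛-assoc B₂ (exp 1ℚ) (exp 1ℚ) n)
                                              (ℚSeries.⊛-cong {a = B₂} (λ _ → refl) (ℚSeries.exp-⊛-exp 1ℚ 1ℚ) n)) ⟩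
      (B₂ ⊛ exp two) n ℚ.+ (B₂ ⊛ exp 1ℚ) n
        ≡⟨ cong (ℚ._+ (B₂ ⊛ exp 1ℚ) n) (B₂-⊛-exp-two n) ⟩
      (B₂ n ℚ.+ two ℚ.* δ₁ n) ℚ.+ (B₂ ⊛ exp 1ℚ) n
        ≡⟨ rearrange (B₂ n) (two ℚ.* δ₁ n) ((B₂ ⊛ exp 1ℚ) n) ⟩
      ((B₂ ⊛ exp 1ℚ) n ℚ.+ B₂ n) ℚ.+ two ℚ.* δ₁ n
        ∎
      where
      rearrange : ∀ x y z → (x ℚ.+ y) ℚ.+ z ≡ (z ℚ.+ x) ℚ.+ y
      rearrange = solve-∀ ℚ-almostCommutativeRing
    rhs : two ⊙ B ⊛ exp 1ℚ ≗ two ⊙ B ⊞ two ⊙ δ₁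
    rhs n = trans (ℚSeries.⊛-⊙ˡ two B (exp 1ℚ) n) (trans (cong (two ℚ.*_) (bernoulli-⊛-exp n)) (ℚ.*-distribˡ-+ two (B n) (δ₁ n)))

  G : Seq
  G = B₂ ⊞ (ℚ.- 1ℚ) ⊙ B

  G-functionalEquation : G ⊛ exp 1ℚ ⊞ G ≗ (ℚ.- 1ℚ) ⊙ δ₁
  G-functionalEquation n = begin
    (G ⊛ exp 1ℚ) n ℚ.+ G n
      ≡⟨ cong (ℚ._+ G n) (trans (ℚSeries.⊛-distribʳ B₂ ((ℚ.- 1ℚ) ⊙ B) (exp 1ℚ) n)
                                (cong ((B₂ ⊛ exp 1ℚ) n ℚ.+_) (ℚSeries.⊛-⊙ˡ (ℚ.- 1ℚ) B (exp 1ℚ) n))) ⟩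
    ((B₂ ⊛ exp 1ℚ) n ℚ.+ ℚ.- 1ℚ ℚ.* (B ⊛ exp 1ℚ) n) ℚ.+ (B₂ n ℚ.+ ℚ.- 1ℚ ℚ.* B n)
      ≡⟨ regroup ((B₂ ⊛ exp 1ℚ) n) ((B ⊛ exp 1ℚ) n) (B₂ n) (B n) ⟩
    ((B₂ ⊛ exp 1ℚ) n ℚ.+ B₂ n) ℚ.+ ℚ.- 1ℚ ℚ.* ((B ⊛ exp 1ℚ) n ℚ.+ B n)
      ≡⟨ cong₂ (λ u v → u ℚ.+ ℚ.- 1ℚ ℚ.* (v ℚ.+ B n)) (bernoulli-duplication n) (bernoulli-⊛-exp n) ⟩
    two ℚ.* B n ℚ.+ ℚ.- 1ℚ ℚ.* ((B n ℚ.+ δ₁ n) ℚ.+ B n)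
      ≡⟨ collapse (B n) (δ₁ n) ⟩
    ℚ.- 1ℚ ℚ.* δ₁ n
      ∎
    where
    open ≡-Reasoning
    regroup : ∀ x y z w → (x ℚ.+ ℚ.- 1ℚ ℚ.* y) ℚ.+ (z ℚ.+ ℚ.- 1ℚ ℚ.* w) ≡ (x ℚ.+ z) ℚ.+ ℚ.- 1ℚ ℚ.* (y ℚ.+ w)
    regroup = solve-∀ ℚ-almostCommutativeRing
    collapse : ∀ b d → two ℚ.* b ℚ.+ ℚ.- 1ℚ ℚ.* ((b ℚ.+ d) ℚ.+ b) ≡ ℚ.- 1ℚ ℚ.* d
    collapse = solve-∀ ℚ-almostCommutativeRing

  G⁻ : Seq
  G⁻ = scale (ℚ.- 1ℚ) G

  G⁻-functionalEquation : G⁻ ⊛ exp 1ℚ ⊞ G⁻ ≗ δ₁ ⊛ exp 1ℚ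
  G⁻-functionalEquation n = sym (begin
    (δ₁ ⊛ exp 1ℚ) n
      ≡⟨ ℚSeries.⊛-cong {b = exp 1ℚ} (sym ∘ reflected) (λ _ → refl) n ⟩
    ((G⁻ ⊛ exp (ℚ.- 1ℚ) ⊞ G⁻) ⊛ exp 1ℚ) n
      ≡⟨ ℚSeries.⊛-distribʳ (G⁻ ⊛ exp (ℚ.- 1ℚ)) G⁻ (exp 1ℚ) n ⟩
    ((G⁻ ⊛ exp (ℚ.- 1ℚ)) ⊛ exp 1ℚ) n ℚ.+ (G⁻ ⊛ exp 1ℚ) n
      ≡⟨ cong (ℚ._+ (G⁻ ⊛ exp 1ℚ) n) (trans (ℚSeries.⊛-assoc G⁻ (exp (ℚ.- 1ℚ)) (exp 1ℚ) n) (ℚSeries.⊛-cong {a = G⁻} (λ _ → refl) e⁻ᶻeᶻ≗1 n)) ⟩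
    (G⁻ ⊛ δ₀) n ℚ.+ (G⁻ ⊛ exp 1ℚ) n
      ≡⟨ cong (ℚ._+ (G⁻ ⊛ exp 1ℚ) n) (ℚSeries.⊛-identityʳ G⁻ n) ⟩
    G⁻ n ℚ.+ (G⁻ ⊛ exp 1ℚ) n
      ≡⟨ ℚ.+-comm (G⁻ n) _ ⟩
    (G⁻ ⊛ exp 1ℚ) n ℚ.+ G⁻ n
      ∎)
    where
    open ≡-Reasoning
    e⁻ᶻeᶻ≗1 : exp (ℚ.- 1ℚ) ⊛ exp 1ℚ ≗ δ₀
    e⁻ᶻeᶻ≗1 k = trans (ℚSeries.exp-⊛-exp (ℚ.- 1ℚ) 1ℚ k) (ℚSeries.exp-0 k)
    reflected : G⁻ ⊛ exp (ℚ.- 1ℚ) ⊞ G⁻ ≗ δ₁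
    reflected k = begin
      (G⁻ ⊛ exp (ℚ.- 1ℚ)) k ℚ.+ G⁻ k
        ≡⟨ cong (ℚ._+ G⁻ k) (trans (ℚSeries.⊛-cong {a = G⁻} (λ _ → refl) (sym ∘ ℚSeries.scale-exp1 (ℚ.- 1ℚ)) k)
                                   (sym (ℚSeries.scale-⊛ (ℚ.- 1ℚ) G (exp 1ℚ) k))) ⟩
      scale (ℚ.- 1ℚ) (G ⊛ exp 1ℚ) k ℚ.+ G⁻ k
        ≡⟨ ℚSeries.scale-⊞ (ℚ.- 1ℚ) (G ⊛ exp 1ℚ) G k ⟨
      scale (ℚ.- 1ℚ) (G ⊛ exp 1ℚ ⊞ G) k
        ≡⟨ cong ((ℚ.- 1ℚ) ℚSeries.^ k ℚ.*_) (G-functionalEquation k) ⟩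
      scale (ℚ.- 1ℚ) ((ℚ.- 1ℚ) ⊙ δ₁) k
        ≡⟨ trans (ℚSeries.scale-⊙ (ℚ.- 1ℚ) (ℚ.- 1ℚ) δ₁ k) (cong (ℚ.- 1ℚ ℚ.*_) (ℚSeries.scale-δ₁ (ℚ.- 1ℚ) k)) ⟩
      ℚ.- 1ℚ ℚ.* (ℚ.- 1ℚ ℚ.* δ₁ k)
        ≡⟨ [-1][-1x]≡x (δ₁ k) ⟩
      δ₁ k
        ∎
      where
      [-1][-1x]≡x : ∀ x → ℚ.- 1ℚ ℚ.* (ℚ.- 1ℚ ℚ.* x) ≡ x
      [-1][-1x]≡x = solve-∀ ℚ-almostCommutativeRing

  tanhCoeff : Seq
  tanhCoeff = ½ ⊙ (G ⊞ G⁻)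

  tanhCoeff-functionalEquation : tanhCoeff ⊛ exp 1ℚ ⊞ tanhCoeff ≗ ½ ⊙ (δ₁ ⊛ exp 1ℚ) ⊞ (ℚ.- ½) ⊙ δ₁
  tanhCoeff-functionalEquation n = begin
    (tanhCoeff ⊛ exp 1ℚ) n ℚ.+ tanhCoeff n
      ≡⟨ cong (ℚ._+ tanhCoeff n) (trans (ℚSeries.⊛-⊙ˡ ½ (G ⊞ G⁻) (exp 1ℚ) n) (cong (½ ℚ.*_) (ℚSeries.⊛-distribʳ G G⁻ (exp 1ℚ) n))) ⟩
    ½ ℚ.* ((G ⊛ exp 1ℚ) n ℚ.+ (G⁻ ⊛ exp 1ℚ) n) ℚ.+ ½ ℚ.* (G n ℚ.+ G⁻ n)
      ≡⟨ regroup ((G ⊛ exp 1ℚ) n) ((G⁻ ⊛ exp 1ℚ) n) (G n) (G⁻ n) ⟩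
    ½ ℚ.* (((G ⊛ exp 1ℚ) n ℚ.+ G n) ℚ.+ ((G⁻ ⊛ exp 1ℚ) n ℚ.+ G⁻ n))
      ≡⟨ cong₂ (λ u v → ½ ℚ.* (u ℚ.+ v)) (G-functionalEquation n) (G⁻-functionalEquation n) ⟩
    ½ ℚ.* (ℚ.- 1ℚ ℚ.* δ₁ n ℚ.+ (δ₁ ⊛ exp 1ℚ) n)
      ≡⟨ distribute (δ₁ n) ((δ₁ ⊛ exp 1ℚ) n) ⟩
    ½ ℚ.* (δ₁ ⊛ exp 1ℚ) n ℚ.+ ℚ.- ½ ℚ.* δ₁ n
      ∎
    where
    open ≡-Reasoning
    regroup : ∀ x y z w → ½ ℚ.* (x ℚ.+ y) ℚ.+ ½ ℚ.* (z ℚ.+ w) ≡ ½ ℚ.* ((x ℚ.+ z) ℚ.+ (y ℚ.+ w))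
    regroup = solve-∀ ℚ-almostCommutativeRing
    distribute : ∀ d e → ½ ℚ.* (ℚ.- 1ℚ ℚ.* d ℚ.+ e) ≡ ½ ℚ.* e ℚ.+ ℚ.- ½ ℚ.* d
    distribute = solve-∀ ℚ-almostCommutativeRing

  [-1]^[2i]≡1 : ∀ i → (ℚ.- 1ℚ) ℚSeries.^ (2 ℕ.* i) ≡ 1ℚ
  [-1]^[2i]≡1 i = trans (sym (^-assocʳ (ℚ.- 1ℚ) 2 i)) (ℚSeries.1^n≡1 i)

  G-even : ∀ i → G (2 ℕ.* i) ≡ ℕ→ℚ (4 ℕ.^ i ∸ 1) ℚ.* B (2 ℕ.* i)
  G-even i = begin
    two ℚSeries.^ (2 ℕ.* i) ℚ.* B (2 ℕ.* i) ℚ.+ ℚ.- 1ℚ ℚ.* B (2 ℕ.* i)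
      ≡⟨ cong (λ x → x ℚ.* B (2 ℕ.* i) ℚ.+ ℚ.- 1ℚ ℚ.* B (2 ℕ.* i)) two^[2i]≡4^i ⟩
    ℕ→ℚ (4 ℕ.^ i) ℚ.* B (2 ℕ.* i) ℚ.+ ℚ.- 1ℚ ℚ.* B (2 ℕ.* i)
      ≡⟨ ℚ.*-distribʳ-+ (B (2 ℕ.* i)) (ℕ→ℚ (4 ℕ.^ i)) (ℚ.- 1ℚ) ⟨
    (ℕ→ℚ (4 ℕ.^ i) ℚ.- 1ℚ) ℚ.* B (2 ℕ.* i)
      ≡⟨ cong (ℚ._* B (2 ℕ.* i)) (ℕ→ℚ-∸ (4 ℕ.^ i) 1 (ℕ.m^n>0 4 i)) ⟨
    ℕ→ℚ (4 ℕ.^ i ∸ 1) ℚ.* B (2 ℕ.* i)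
      ∎
    where
    open ≡-Reasoning
    two^[2i]≡4^i : two ℚSeries.^ (2 ℕ.* i) ≡ ℕ→ℚ (4 ℕ.^ i)
    two^[2i]≡4^i = trans (sym (ℕ→ℚ-^ 2 (2 ℕ.* i))) (cong ℕ→ℚ (sym (ℕ.^-*-assoc 2 2 i)))

  tanhCoeff-even : ∀ i → tanhCoeff (2 ℕ.* i) ≡ ℕ→ℚ (4 ℕ.^ i ∸ 1) ℚ.* B (2 ℕ.* i)
  tanhCoeff-even i = begin
    ½ ℚ.* (G (2 ℕ.* i) ℚ.+ (ℚ.- 1ℚ) ℚSeries.^ (2 ℕ.* i) ℚ.* G (2 ℕ.* i))   ≡⟨ cong (λ s → ½ ℚ.* (G (2 ℕ.* i) ℚ.+ s ℚ.* G (2 ℕ.* i))) ([-1]^[2i]≡1 i) ⟩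
    ½ ℚ.* (G (2 ℕ.* i) ℚ.+ 1ℚ ℚ.* G (2 ℕ.* i))                             ≡⟨ half-double (G (2 ℕ.* i)) ⟩
    G (2 ℕ.* i)                                                            ≡⟨ G-even i ⟩
    ℕ→ℚ (4 ℕ.^ i ∸ 1) ℚ.* B (2 ℕ.* i)                                      ∎
    where
    open ≡-Reasoning
    half-double : ∀ x → ½ ℚ.* (x ℚ.+ 1ℚ ℚ.* x) ≡ x
    half-double = solve-∀ ℚ-almostCommutativeRing

  tanhCoeff-odd : ∀ i → tanhCoeff (suc (2 ℕ.* i)) ≡ 0ℚ
  tanhCoeff-odd i = begin
    ½ ℚ.* (G k ℚ.+ (ℚ.- 1ℚ ℚ.* (ℚ.- 1ℚ) ℚSeries.^ (2 ℕ.* i)) ℚ.* G k)   ≡⟨ cong (λ s → ½ ℚ.* (G k ℚ.+ (ℚ.- 1ℚ ℚ.* s) ℚ.* G k)) ([-1]^[2i]≡1 i) ⟩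
    ½ ℚ.* (G k ℚ.+ (ℚ.- 1ℚ ℚ.* 1ℚ) ℚ.* G k)                              ≡⟨ cancel (G k) ⟩
    0ℚ                                                                   ∎
    where
    open ≡-Reasoning
    k = suc (2 ℕ.* i)
    cancel : ∀ x → ½ ℚ.* (x ℚ.+ (ℚ.- 1ℚ ℚ.* 1ℚ) ℚ.* x) ≡ 0ℚ
    cancel = solve-∀ ℚ-almostCommutativeRing

open Bernoulli using (tanhCoeff; tanhCoeff-functionalEquation; tanhCoeff-even; tanhCoeff-odd)

infix 5 _+√5_
record ℚ√5 : Set where
  constructor _+√5_
  field
    re im : ℚ

five : ℚ
five = ℤ.+ 5 ℚ./ 1

module ℚ√5-Ring where
  infixl 6 _+_
  infixl 7 _*_
  infix  8 -_

  _+_ : ℚ√5 → ℚ√5 → ℚ√5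
  (a +√5 b) + (c +√5 d) = a ℚ.+ c +√5 b ℚ.+ d

  _*_ : ℚ√5 → ℚ√5 → ℚ√5
  (a +√5 b) * (c +√5 d) = a ℚ.* c ℚ.+ five ℚ.* (b ℚ.* d) +√5 a ℚ.* d ℚ.+ b ℚ.* c

  -_ : ℚ√5 → ℚ√5
  - (a +√5 b) = ℚ.- a +√5 ℚ.- b

  0ᴷ 1ᴷ : ℚ√5
  0ᴷ = 0ℚ +√5 0ℚ
  1ᴷ = 1ℚ +√5 0ℚ

  isCommutativeRing : IsCommutativeRing _≡_ _+_ _*_ -_ 0ᴷ 1ᴷ
  isCommutativeRing = record
    { isRing = record
      { +-isAbelianGroup = record
        { isGroup = record
          { isMonoid = record
            { isSemigroup = record
              { isMagma = record { isEquivalence = isEquivalence ; ∙-cong = cong₂ _+_ }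
              ; assoc = +-assoc }
            ; identity = comm∧idˡ⇒id +-comm +-identityˡ }
          ; inverse = comm∧invˡ⇒inv +-comm -‿inverseˡ
          ; ⁻¹-cong = cong -_ }
        ; comm = +-comm }
      ; *-cong = cong₂ _*_
      ; *-assoc = *-assoc
      ; *-identity = comm∧idˡ⇒id *-comm *-identityˡ
      ; distrib = distribˡ , comm∧distrˡ⇒distrʳ *-comm distribˡ
      }
    ; *-comm = *-comm }
    where
    +-assoc : ∀ x y z → (x + y) + z ≡ x + (y + z)
    +-assoc (a +√5 b) (c +√5 d) (e +√5 f) = cong₂ _+√5_ (ℚ.+-assoc a c e) (ℚ.+-assoc b d f)
    +-comm : ∀ x y → x + y ≡ y + x
    +-comm (a +√5 b) (c +√5 d) = cong₂ _+√5_ (ℚ.+-comm a c) (ℚ.+-comm b d)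
    +-identityˡ : ∀ x → 0ᴷ + x ≡ x
    +-identityˡ (a +√5 b) = cong₂ _+√5_ (ℚ.+-identityˡ a) (ℚ.+-identityˡ b)
    -‿inverseˡ : ∀ x → - x + x ≡ 0ᴷ
    -‿inverseˡ (a +√5 b) = cong₂ _+√5_ (ℚ.+-inverseˡ a) (ℚ.+-inverseˡ b)
    *-assoc : ∀ x y z → (x * y) * z ≡ x * (y * z)
    *-assoc (a +√5 b) (c +√5 d) (e +√5 f) = cong₂ _+√5_ (re-assoc a b c d e f) (im-assoc a b c d e f)
      where
      re-assoc : ∀ a b c d e f → (a ℚ.* c ℚ.+ five ℚ.* (b ℚ.* d)) ℚ.* e ℚ.+ five ℚ.* ((a ℚ.* d ℚ.+ b ℚ.* c) ℚ.* f)
                                 ≡ a ℚ.* (c ℚ.* e ℚ.+ five ℚ.* (d ℚ.* f)) ℚ.+ five ℚ.* (b ℚ.* (c ℚ.* f ℚ.+ d ℚ.* e))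
      re-assoc = solve-∀ ℚ-almostCommutativeRing
      im-assoc : ∀ a b c d e f → (a ℚ.* c ℚ.+ five ℚ.* (b ℚ.* d)) ℚ.* f ℚ.+ (a ℚ.* d ℚ.+ b ℚ.* c) ℚ.* e
                                 ≡ a ℚ.* (c ℚ.* f ℚ.+ d ℚ.* e) ℚ.+ b ℚ.* (c ℚ.* e ℚ.+ five ℚ.* (d ℚ.* f))
      im-assoc = solve-∀ ℚ-almostCommutativeRing
    *-comm : ∀ x y → x * y ≡ y * x
    *-comm (a +√5 b) (c +√5 d) = cong₂ _+√5_ (re-comm a b c d) (im-comm a b c d)
      where
      re-comm : ∀ a b c d → a ℚ.* c ℚ.+ five ℚ.* (b ℚ.* d) ≡ c ℚ.* a ℚ.+ five ℚ.* (d ℚ.* b)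
      re-comm = solve-∀ ℚ-almostCommutativeRing
      im-comm : ∀ a b c d → a ℚ.* d ℚ.+ b ℚ.* c ≡ c ℚ.* b ℚ.+ d ℚ.* a
      im-comm = solve-∀ ℚ-almostCommutativeRing
    *-identityˡ : ∀ x → 1ᴷ * x ≡ x
    *-identityˡ (a +√5 b) = cong₂ _+√5_ (re-identity a b) (im-identity a b)
      where
      re-identity : ∀ a b → 1ℚ ℚ.* a ℚ.+ five ℚ.* (0ℚ ℚ.* b) ≡ a
      re-identity = solve-∀ ℚ-almostCommutativeRing
      im-identity : ∀ a b → 1ℚ ℚ.* b ℚ.+ 0ℚ ℚ.* a ≡ b
      im-identity = solve-∀ ℚ-almostCommutativeRing
    distribˡ : ∀ x y z → x * (y + z) ≡ x * y + x * z
    distribˡ (a +√5 b) (c +√5 d) (e +√5 f) = cong₂ _+√5_ (re-distrib a b c d e f) (im-distrib a b c d e f)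
      where
      re-distrib : ∀ a b c d e f → a ℚ.* (c ℚ.+ e) ℚ.+ five ℚ.* (b ℚ.* (d ℚ.+ f))
                                   ≡ (a ℚ.* c ℚ.+ five ℚ.* (b ℚ.* d)) ℚ.+ (a ℚ.* e ℚ.+ five ℚ.* (b ℚ.* f))
      re-distrib = solve-∀ ℚ-almostCommutativeRing
      im-distrib : ∀ a b c d e f → a ℚ.* (d ℚ.+ f) ℚ.+ b ℚ.* (c ℚ.+ e) ≡ (a ℚ.* d ℚ.+ b ℚ.* c) ℚ.+ (a ℚ.* f ℚ.+ b ℚ.* e)
      im-distrib = solve-∀ ℚ-almostCommutativeRing

module ℚ√5Series = ExponentialSeries ℚ√5-Ring.isCommutativeRing

ℚ√5-almostCommutativeRing : ACR.AlmostCommutativeRing 0ℓ 0ℓ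
ℚ√5-almostCommutativeRing = ACR.fromCommutativeRing ℚ√5Series.commutativeRing isZero
  where
  isZero : ∀ x → Maybe (ℚ√5-Ring.0ᴷ ≡ x)
  isZero (a +√5 b) with 0ℚ ℚ.≟ a | 0ℚ ℚ.≟ b
  ... | yes refl | yes refl = just refl
  ... | _        | _        = nothing

module Embedding where

  open ℚ√5-Ring using (_+_; _*_; -_; 1ᴷ)
  open ℚ√5Series using (_^_; _×_; _⊛_; _⊞_; _⊙_; exp; δ₁; ∑≤)

  ι : ℚ → ℚ√5
  ι q = q +√5 0ℚ

  ι-injective : ∀ {p q} → ι p ≡ ι q → p ≡ q
  ι-injective = cong ℚ√5.re

  ι-* : ∀ p q → ι (p ℚ.* q) ≡ ι p * ι q
  ι-* p q = sym (cong₂ _+√5_ (re-* p q) (im-* p q))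
    where
    re-* : ∀ p q → p ℚ.* q ℚ.+ five ℚ.* (0ℚ ℚ.* 0ℚ) ≡ p ℚ.* q
    re-* = solve-∀ ℚ-almostCommutativeRing
    im-* : ∀ p q → p ℚ.* 0ℚ ℚ.+ 0ℚ ℚ.* q ≡ 0ℚ
    im-* = solve-∀ ℚ-almostCommutativeRing

  ι-× : ∀ n q → ι (n ℚSeries.× q) ≡ n × ι q
  ι-× zero    q = refl
  ι-× (suc n) q = cong (λ x → ι q + x) (ι-× n q)

  ι-^ : ∀ q n → ι (q ℚSeries.^ n) ≡ ι q ^ n
  ι-^ q zero    = refl
  ι-^ q (suc n) = trans (ι-* q (q ℚSeries.^ n)) (cong (ι q *_) (ι-^ q n))

  ι-∑≤ : ∀ n f → ι (ℚSeries.∑≤ n f) ≡ ∑≤ n (ι ∘ f)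
  ι-∑≤ zero    f = refl
  ι-∑≤ (suc n) f = cong (λ x → x + ι (f (suc n))) (ι-∑≤ n f)

  ι-⊛ : ∀ a b → ι ∘ (a ℚSeries.⊛ b) ≗ (ι ∘ a) ⊛ (ι ∘ b)
  ι-⊛ a b n = trans (ι-∑≤ n _) (ℚ√5Series.∑≤-cong n λ {k} _ →
    trans (ι-× (n C k) (a k ℚ.* b (n ∸ k))) (cong ((n C k) ×_) (ι-* (a k) (b (n ∸ k)))))

  ι-δ₁ : ι ∘ ℚSeries.δ₁ ≗ δ₁
  ι-δ₁ zero          = refl
  ι-δ₁ (suc zero)    = refl
  ι-δ₁ (suc (suc _)) = refl

  ×≡ι* : ∀ n x → n × x ≡ ι (ℕ→ℚ n) * x
  ×≡ι* n x = trans (ℚ√5Series.×≡×1* n x) (cong (_* x) n×1≡n)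
    where
    n×1≡n : n × 1ᴷ ≡ ι (ℕ→ℚ n)
    n×1≡n = trans (sym (ι-× n 1ℚ)) (cong ι (trans (×≡ℕ→ℚ* n 1ℚ) (ℚ.*-identityʳ (ℕ→ℚ n))))

  ι∘tanhCoeff-functionalEquation : (ι ∘ tanhCoeff) ⊛ exp 1ᴷ ⊞ ι ∘ tanhCoeff ≗ ι ½ ⊙ (δ₁ ⊛ exp 1ᴷ) ⊞ (- ι ½) ⊙ δ₁
  ι∘tanhCoeff-functionalEquation n = begin
    ((ι ∘ tanhCoeff) ⊛ exp 1ᴷ) n + ι (tanhCoeff n)
      ≡⟨ cong (λ x → x + ι (tanhCoeff n)) (trans (ℚ√5Series.⊛-cong {a = ι ∘ tanhCoeff} (λ _ → refl) (sym ∘ ι-^ 1ℚ) n)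
                                                 (sym (ι-⊛ tanhCoeff (ℚSeries.exp 1ℚ) n))) ⟩
    ι ((tanhCoeff ℚSeries.⊛ ℚSeries.exp 1ℚ) n ℚ.+ tanhCoeff n)
      ≡⟨ cong ι (tanhCoeff-functionalEquation n) ⟩
    ι (½ ℚ.* (ℚSeries.δ₁ ℚSeries.⊛ ℚSeries.exp 1ℚ) n ℚ.+ ℚ.- ½ ℚ.* ℚSeries.δ₁ n)
      ≡⟨ cong₂ _+_ (ι-* ½ ((ℚSeries.δ₁ ℚSeries.⊛ ℚSeries.exp 1ℚ) n)) (ι-* (ℚ.- ½) (ℚSeries.δ₁ n)) ⟩
    ι ½ * ι ((ℚSeries.δ₁ ℚSeries.⊛ ℚSeries.exp 1ℚ) n) + - ι ½ * ι (ℚSeries.δ₁ n)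
      ≡⟨ cong₂ (λ u v → ι ½ * u + - ι ½ * v) (trans (ι-⊛ ℚSeries.δ₁ (ℚSeries.exp 1ℚ) n) (ℚ√5Series.⊛-cong ι-δ₁ (ι-^ 1ℚ) n)) (ι-δ₁ n) ⟩
    ι ½ * (δ₁ ⊛ exp 1ᴷ) n + - ι ½ * δ₁ n
      ∎
    where open ≡-Reasoning

module Binet where

  open ℚ√5-Ring using (_+_; _*_; -_; 0ᴷ; 1ᴷ)
  open ℚ√5Series using (_-_; _^_; _×_; _⊛_; _⊞_; exp; scale; ∑≤)
  open CommutativeRing ℚ√5Series.commutativeRing using (+-assoc; *-assoc; *-identityˡ; *-identityʳ; distribʳ; zeroˡ; zeroʳ)
  open import Algebra.Properties.Semiring.Exp (CommutativeRing.semiring ℚ√5Series.commutativeRing) using (^-assocʳ)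
  open import Algebra.Properties.AbelianGroup (CommutativeRing.+-abelianGroup ℚ√5Series.commutativeRing) using (xyx⁻¹≈y)
  open Embedding

  ^-fibonacci : ∀ x → x * x ≡ x + 1ᴷ → ∀ t → x ^ suc (suc t) ≡ x ^ suc t + x ^ t
  ^-fibonacci x x²≡x+1 t = begin
    x * (x * x ^ t)           ≡⟨ *-assoc x x (x ^ t) ⟨
    (x * x) * x ^ t           ≡⟨ cong (_* x ^ t) x²≡x+1 ⟩
    (x + 1ᴷ) * x ^ t          ≡⟨ distribʳ (x ^ t) x 1ᴷ ⟩
    x * x ^ t + 1ᴷ * x ^ t    ≡⟨ cong (λ y → x * x ^ t + y) (*-identityˡ (x ^ t)) ⟩
    x * x ^ t + x ^ t         ∎
    where open ≡-Reasoning

  binet : ∀ σ → (½ +√5 σ) * (½ +√5 σ) ≡ (½ +√5 σ) + 1ᴷ →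
          ∀ t → (½ +√5 σ) ^ t ≡ ℕ→ℚ (lucas t) ℚ.* ½ +√5 ℕ→ℚ (fib t) ℚ.* σ
  binet σ x²≡x+1 zero          = cong (λ y → 1ℚ +√5 y) (sym (ℚ.*-zeroˡ σ))
  binet σ x²≡x+1 (suc zero)    = cong₂ _+√5_ (re-1 σ) (im-1 σ)
    where
    re-1 : ∀ σ → ½ ℚ.* 1ℚ ℚ.+ five ℚ.* (σ ℚ.* 0ℚ) ≡ 1ℚ ℚ.* ½
    re-1 = solve-∀ ℚ-almostCommutativeRing
    im-1 : ∀ σ → ½ ℚ.* 0ℚ ℚ.+ σ ℚ.* 1ℚ ≡ 1ℚ ℚ.* σ
    im-1 = solve-∀ ℚ-almostCommutativeRing
  binet σ x²≡x+1 (suc (suc t)) = begin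
    (½ +√5 σ) ^ suc (suc t)
      ≡⟨ ^-fibonacci (½ +√5 σ) x²≡x+1 t ⟩
    (½ +√5 σ) ^ suc t + (½ +√5 σ) ^ t
      ≡⟨ cong₂ _+_ (binet σ x²≡x+1 (suc t)) (binet σ x²≡x+1 t) ⟩
    (ℕ→ℚ (lucas (suc t)) ℚ.* ½ +√5 ℕ→ℚ (fib (suc t)) ℚ.* σ) + (ℕ→ℚ (lucas t) ℚ.* ½ +√5 ℕ→ℚ (fib t) ℚ.* σ)
      ≡⟨ cong₂ _+√5_ (sum-of-terms (lucas (suc t)) (lucas t) ½) (sum-of-terms (fib (suc t)) (fib t) σ) ⟩
    ℕ→ℚ (lucas (suc (suc t))) ℚ.* ½ +√5 ℕ→ℚ (fib (suc (suc t))) ℚ.* σ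
      ∎
    where
    open ≡-Reasoning
    sum-of-terms : ∀ m n q → ℕ→ℚ m ℚ.* q ℚ.+ ℕ→ℚ n ℚ.* q ≡ ℕ→ℚ (m ℕ.+ n) ℚ.* q
    sum-of-terms m n q = trans (sym (ℚ.*-distribʳ-+ q (ℕ→ℚ m) (ℕ→ℚ n))) (cong (ℚ._* q) (sym (ℕ→ℚ-+ m n)))

  φ ψ : ℚ√5
  φ = ½ +√5 ½
  ψ = ½ +√5 ℚ.- ½

  φ^t : ∀ t → φ ^ t ≡ ℕ→ℚ (lucas t) ℚ.* ½ +√5 ℕ→ℚ (fib t) ℚ.* ½
  φ^t = binet ½ refl

  ψ^t : ∀ t → ψ ^ t ≡ ℕ→ℚ (lucas t) ℚ.* ½ +√5 ℕ→ℚ (fib t) ℚ.* ℚ.- ½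
  ψ^t = binet (ℚ.- ½) refl

  √5-product : ∀ p q → (0ℚ +√5 p) * (0ℚ +√5 q) ≡ ι (five ℚ.* (p ℚ.* q))
  √5-product p q = cong₂ _+√5_ (re-product p q) (im-product p q)
    where
    re-product : ∀ p q → 0ℚ ℚ.* 0ℚ ℚ.+ five ℚ.* (p ℚ.* q) ≡ five ℚ.* (p ℚ.* q)
    re-product = solve-∀ ℚ-almostCommutativeRing
    im-product : ∀ p q → 0ℚ ℚ.* q ℚ.+ p ℚ.* 0ℚ ≡ 0ℚ
    im-product = solve-∀ ℚ-almostCommutativeRing

  module Identity (j : ℕ) where

    α β d : ℚ√5
    α = φ ^ (2 ℕ.* j)
    β = ψ ^ (2 ℕ.* j)
    d = α - β

    α^m : ∀ m → α ^ m ≡ ℕ→ℚ (lucas (2 ℕ.* j ℕ.* m)) ℚ.* ½ +√5 ℕ→ℚ (fib (2 ℕ.* j ℕ.* m)) ℚ.* ½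
    α^m m = trans (^-assocʳ φ (2 ℕ.* j) m) (φ^t (2 ℕ.* j ℕ.* m))

    β^m : ∀ m → β ^ m ≡ ℕ→ℚ (lucas (2 ℕ.* j ℕ.* m)) ℚ.* ½ +√5 ℕ→ℚ (fib (2 ℕ.* j ℕ.* m)) ℚ.* ℚ.- ½
    β^m m = trans (^-assocʳ ψ (2 ℕ.* j) m) (ψ^t (2 ℕ.* j ℕ.* m))

    lucas-sum : ∀ m → α ^ m + β ^ m ≡ ι (ℕ→ℚ (lucas (2 ℕ.* j ℕ.* m)))
    lucas-sum m = begin
      α ^ m + β ^ m
        ≡⟨ cong₂ _+_ (α^m m) (β^m m) ⟩
      (l ℚ.* ½ +√5 f ℚ.* ½) + (l ℚ.* ½ +√5 f ℚ.* ℚ.- ½)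
        ≡⟨ cong₂ _+√5_ (halves l) (opposite f) ⟩
      ι l
        ∎
      where
      open ≡-Reasoning
      l = ℕ→ℚ (lucas (2 ℕ.* j ℕ.* m))
      f = ℕ→ℚ (fib (2 ℕ.* j ℕ.* m))
      halves : ∀ l → l ℚ.* ½ ℚ.+ l ℚ.* ½ ≡ l
      halves = solve-∀ ℚ-almostCommutativeRing
      opposite : ∀ f → f ℚ.* ½ ℚ.+ f ℚ.* ℚ.- ½ ≡ 0ℚ
      opposite = solve-∀ ℚ-almostCommutativeRing

    fib-difference : ∀ m → α ^ m - β ^ m ≡ 0ℚ +√5 ℕ→ℚ (fib (2 ℕ.* j ℕ.* m))
    fib-difference m = begin
      α ^ m - β ^ m
        ≡⟨ cong₂ _-_ (α^m m) (β^m m) ⟩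
      (l ℚ.* ½ +√5 f ℚ.* ½) - (l ℚ.* ½ +√5 f ℚ.* ℚ.- ½)
        ≡⟨ cong₂ _+√5_ (cancel l) (halves f) ⟩
      0ℚ +√5 f
        ∎
      where
      open ≡-Reasoning
      l = ℕ→ℚ (lucas (2 ℕ.* j ℕ.* m))
      f = ℕ→ℚ (fib (2 ℕ.* j ℕ.* m))
      cancel : ∀ l → l ℚ.* ½ ℚ.+ ℚ.- (l ℚ.* ½) ≡ 0ℚ
      cancel = solve-∀ ℚ-almostCommutativeRing
      halves : ∀ f → f ℚ.* ½ ℚ.+ ℚ.- (f ℚ.* ℚ.- ½) ≡ f
      halves = solve-∀ ℚ-almostCommutativeRing

    d≡√5F : d ≡ 0ℚ +√5 ℕ→ℚ (fib (2 ℕ.* j))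
    d≡√5F = begin
      α - β                    ≡⟨ cong₂ _-_ (*-identityʳ α) (*-identityʳ β) ⟨
      α ^ 1 - β ^ 1            ≡⟨ fib-difference 1 ⟩
      0ℚ +√5 ℕ→ℚ (fib (2 ℕ.* j ℕ.* 1))  ≡⟨ cong (λ m → 0ℚ +√5 ℕ→ℚ (fib m)) (ℕ.*-identityʳ (2 ℕ.* j)) ⟩
      0ℚ +√5 ℕ→ℚ (fib (2 ℕ.* j))        ∎
      where open ≡-Reasoning

    β+d≡α : β + d ≡ α
    β+d≡α = trans (sym (+-assoc β α (- β))) (xyx⁻¹≈y β α)

    d^[2i] : ∀ i → d ^ (2 ℕ.* i) ≡ ι (ℕ→ℚ (5 ℕ.^ i ℕ.* fib (2 ℕ.* j) ℕ.^ (2 ℕ.* i)))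
    d^[2i] i = begin
      d ^ (2 ℕ.* i)                                  ≡⟨ ^-assocʳ d 2 i ⟨
      (d * (d * 1ᴷ)) ^ i                             ≡⟨ cong (λ x → (d * x) ^ i) (*-identityʳ d) ⟩
      (d * d) ^ i                                    ≡⟨ cong (λ x → (x * x) ^ i) d≡√5F ⟩
      ((0ℚ +√5 F) * (0ℚ +√5 F)) ^ i                  ≡⟨ cong (_^ i) (√5-product F F) ⟩
      ι (five ℚ.* (F ℚ.* F)) ^ i                     ≡⟨ cong (λ q → ι q ^ i) (sym (trans (ℕ→ℚ-* 5 (f ℕ.* f)) (cong (five ℚ.*_) (ℕ→ℚ-* f f)))) ⟩
      ι (ℕ→ℚ (5 ℕ.* (f ℕ.* f))) ^ i                  ≡⟨ trans (sym (ι-^ (ℕ→ℚ (5 ℕ.* (f ℕ.* f))) i)) (cong ι (sym (ℕ→ℚ-^ (5 ℕ.* (f ℕ.* f)) i))) ⟩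
      ι (ℕ→ℚ ((5 ℕ.* (f ℕ.* f)) ℕ.^ i))              ≡⟨ cong (ι ∘ ℕ→ℚ) (trans (^-distribʳ-* 5 (f ℕ.* f) i) (cong (5 ℕ.^ i ℕ.*_) [f*f]^i≡f^[2i])) ⟩
      ι (ℕ→ℚ (5 ℕ.^ i ℕ.* f ℕ.^ (2 ℕ.* i)))          ∎
      where
      open ≡-Reasoning
      f = fib (2 ℕ.* j)
      F = ℕ→ℚ f
      [f*f]^i≡f^[2i] : (f ℕ.* f) ℕ.^ i ≡ f ℕ.^ (2 ℕ.* i)
      [f*f]^i≡f^[2i] = trans (cong (λ x → (f ℕ.* x) ℕ.^ i) (sym (ℕ.*-identityʳ f))) (ℕ.^-*-assoc f 2 i)

    series : ℚ√5Series.Seq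
    series = scale d (ι ∘ tanhCoeff) ⊛ (exp α ⊞ exp β)

    series-term : ℕ → ℕ → ℚ√5
    series-term n k = (n C k) × (d ^ k * ι (tanhCoeff k) * (α ^ (n ∸ k) + β ^ (n ∸ k)))

    summand : ℕ → ℕ → ℚ
    summand n i = ℕ→ℚ (n C (2 ℕ.* i)) ℚ.* ℕ→ℚ (20 ℕ.^ i ∸ 5 ℕ.^ i) ℚ.* ℕ→ℚ (fib (2 ℕ.* j) ℕ.^ (2 ℕ.* i))
                    ℚ.* B (2 ℕ.* i) ℚ.* ℕ→ℚ (lucas (2 ℕ.* j ℕ.* (n ∸ 2 ℕ.* i)))

    series-odd : ∀ n i → series-term n (suc (2 ℕ.* i)) ≡ 0ᴷ
    series-odd n i = begin
      k× (d ^ k * ι (tanhCoeff k) * s)     ≡⟨ cong (λ q → k× (d ^ k * ι q * s)) (tanhCoeff-odd i) ⟩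
      k× (d ^ k * 0ᴷ * s)                  ≡⟨ cong (λ x → k× (x * s)) (zeroʳ (d ^ k)) ⟩
      k× (0ᴷ * s)                          ≡⟨ cong k×_ (zeroˡ s) ⟩
      k× 0ᴷ                                ≡⟨ ℚ√5Series.×-zeroʳ (n C k) ⟩
      0ᴷ                                   ∎
      where
      open ≡-Reasoning
      k = suc (2 ℕ.* i)
      s = α ^ (n ∸ k) + β ^ (n ∸ k)
      k×_ : ℚ√5 → ℚ√5
      k× x = (n C k) × x

    series-even : ∀ n i → series-term n (2 ℕ.* i) ≡ ι (summand n i)
    series-even n i = begin
      c × (d ^ k * ι (tanhCoeff k) * (α ^ (n ∸ k) + β ^ (n ∸ k)))
        ≡⟨ cong₂ (λ x y → c × (d ^ k * ι x * y)) (tanhCoeff-even i) (lucas-sum (n ∸ k)) ⟩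
      c × (d ^ k * ι (t ℚ.* B k) * ι l)
        ≡⟨ cong (λ x → c × (x * ι (t ℚ.* B k) * ι l)) (d^[2i] i) ⟩
      c × (ι (ℕ→ℚ (5 ℕ.^ i ℕ.* f)) * ι (t ℚ.* B k) * ι l)
        ≡⟨ cong (c ×_) (sym (trans (ι-* (ℕ→ℚ (5 ℕ.^ i ℕ.* f) ℚ.* (t ℚ.* B k)) l) (cong (_* ι l) (ι-* (ℕ→ℚ (5 ℕ.^ i ℕ.* f)) (t ℚ.* B k))))) ⟩
      c × ι (ℕ→ℚ (5 ℕ.^ i ℕ.* f) ℚ.* (t ℚ.* B k) ℚ.* l)
        ≡⟨ sym (ι-× c (ℕ→ℚ (5 ℕ.^ i ℕ.* f) ℚ.* (t ℚ.* B k) ℚ.* l)) ⟩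
      ι (c ℚSeries.× (ℕ→ℚ (5 ℕ.^ i ℕ.* f) ℚ.* (t ℚ.* B k) ℚ.* l))
        ≡⟨ cong ι (trans (×≡ℕ→ℚ* c (ℕ→ℚ (5 ℕ.^ i ℕ.* f) ℚ.* (t ℚ.* B k) ℚ.* l)) (cong (λ x → ℕ→ℚ c ℚ.* (x ℚ.* (t ℚ.* B k) ℚ.* l)) (ℕ→ℚ-* (5 ℕ.^ i) f))) ⟩
      ι (ℕ→ℚ c ℚ.* (ℕ→ℚ (5 ℕ.^ i) ℚ.* ℕ→ℚ f ℚ.* (t ℚ.* B k) ℚ.* l))
        ≡⟨ cong ι (rearrange (ℕ→ℚ c) (ℕ→ℚ (5 ℕ.^ i)) (ℕ→ℚ f) t (B k) l) ⟩
      ι (ℕ→ℚ c ℚ.* (ℕ→ℚ (5 ℕ.^ i) ℚ.* t) ℚ.* ℕ→ℚ f ℚ.* B k ℚ.* l)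
        ≡⟨ cong (λ x → ι (ℕ→ℚ c ℚ.* x ℚ.* ℕ→ℚ f ℚ.* B k ℚ.* l)) (trans (sym (ℕ→ℚ-* (5 ℕ.^ i) (4 ℕ.^ i ∸ 1))) (cong ℕ→ℚ 5^i[4^i-1]≡20^i-5^i)) ⟩
      ι (summand n i)
        ∎
      where
      open ≡-Reasoning
      k = 2 ℕ.* i
      c = n C k
      f = fib (2 ℕ.* j) ℕ.^ k
      t = ℕ→ℚ (4 ℕ.^ i ∸ 1)
      l = ℕ→ℚ (lucas (2 ℕ.* j ℕ.* (n ∸ k)))
      rearrange : ∀ c p f t b l → c ℚ.* (p ℚ.* f ℚ.* (t ℚ.* b) ℚ.* l) ≡ c ℚ.* (p ℚ.* t) ℚ.* f ℚ.* b ℚ.* l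
      rearrange = solve-∀ ℚ-almostCommutativeRing
      5^i[4^i-1]≡20^i-5^i : 5 ℕ.^ i ℕ.* (4 ℕ.^ i ∸ 1) ≡ 20 ℕ.^ i ∸ 5 ℕ.^ i
      5^i[4^i-1]≡20^i-5^i = trans (ℕ.*-distribˡ-∸ (5 ℕ.^ i) (4 ℕ.^ i) 1)
                                 (cong₂ _∸_ (sym (^-distribʳ-* 5 4 i)) (ℕ.*-identityʳ (5 ℕ.^ i)))

    series≡sum : ∀ n → series n ≡ ι (sumTo (n / 2) (summand n))
    series≡sum n = begin
      series n                                    ≡⟨ ℚ√5Series.∑≤-evens n _ (series-odd n) ⟩
      ∑≤ (n / 2) (series-term n ∘ (2 ℕ.*_))       ≡⟨ ℚ√5Series.∑≤-cong (n / 2) (λ {i} _ → series-even n i) ⟩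
      ∑≤ (n / 2) (ι ∘ summand n)                  ≡⟨ ι-∑≤ (n / 2) (summand n) ⟨
      ι (ℚSeries.∑≤ (n / 2) (summand n))          ≡⟨ cong ι (sumTo≡∑≤ (n / 2) (summand n)) ⟨
      ι (sumTo (n / 2) (summand n))               ∎
      where open ≡-Reasoning

    series≡closedForm : ∀ n → series n ≡ ι (ℤ.+ (5 ℕ.* n ℕ.* fib (2 ℕ.* j) ℕ.* fib (2 ℕ.* j ℕ.* (n ∸ 1))) ℚ./ 2)
    series≡closedForm n = begin
      series n
        ≡⟨ ℚ√5Series.⊛-cong {a = scale d (ι ∘ tanhCoeff)} (λ _ → refl) (λ k → cong (λ x → x ^ k + β ^ k) (sym β+d≡α)) n ⟩
      (scale d (ι ∘ tanhCoeff) ⊛ (exp (β + d) ⊞ exp β)) n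
        ≡⟨ ℚ√5Series.scale-⊛-exp-sum (ι ∘ tanhCoeff) (ι ½) ι∘tanhCoeff-functionalEquation β d n ⟩
      ι ½ * d * n × (β + d) ^ (n ∸ 1) + - ι ½ * d * n × β ^ (n ∸ 1)
        ≡⟨ cong₂ (λ x y → ι ½ * d * x + - ι ½ * d * y) (trans (cong (λ x → n × x ^ (n ∸ 1)) β+d≡α) (×≡ι* n (α ^ (n ∸ 1)))) (×≡ι* n (β ^ (n ∸ 1))) ⟩
      ι ½ * d * (N * α ^ (n ∸ 1)) + - ι ½ * d * (N * β ^ (n ∸ 1))
        ≡⟨ factor (ι ½) d N (α ^ (n ∸ 1)) (β ^ (n ∸ 1)) ⟩
      ι ½ * N * (d * (α ^ (n ∸ 1) - β ^ (n ∸ 1)))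
        ≡⟨ cong₂ (λ x y → ι ½ * N * (x * y)) d≡√5F (fib-difference (n ∸ 1)) ⟩
      ι ½ * N * ((0ℚ +√5 F) * (0ℚ +√5 F′))
        ≡⟨ cong (ι ½ * N *_) (√5-product F F′) ⟩
      ι ½ * N * ι (five ℚ.* (F ℚ.* F′))
        ≡⟨ trans (cong (_* ι (five ℚ.* (F ℚ.* F′))) (sym (ι-* ½ (ℕ→ℚ n)))) (sym (ι-* (½ ℚ.* ℕ→ℚ n) (five ℚ.* (F ℚ.* F′)))) ⟩
      ι (½ ℚ.* ℕ→ℚ n ℚ.* (five ℚ.* (F ℚ.* F′)))
        ≡⟨ cong ι (trans (rearrange (ℕ→ℚ n) F F′) (sym (trans ([+m]/2≡m*½ (5 ℕ.* n ℕ.* fib (2 ℕ.* j) ℕ.* fib (2 ℕ.* j ℕ.* (n ∸ 1)))) (cong (ℚ._* ½) expand)))) ⟩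
      ι (ℤ.+ (5 ℕ.* n ℕ.* fib (2 ℕ.* j) ℕ.* fib (2 ℕ.* j ℕ.* (n ∸ 1))) ℚ./ 2)
        ∎
      where
      open ≡-Reasoning
      N = ι (ℕ→ℚ n)
      F = ℕ→ℚ (fib (2 ℕ.* j))
      F′ = ℕ→ℚ (fib (2 ℕ.* j ℕ.* (n ∸ 1)))
      factor : ∀ c d N x y → c * d * (N * x) + - c * d * (N * y) ≡ c * N * (d * (x + - y))
      factor = solve-∀ ℚ√5-almostCommutativeRing
      rearrange : ∀ n f f′ → ½ ℚ.* n ℚ.* (five ℚ.* (f ℚ.* f′)) ≡ five ℚ.* n ℚ.* f ℚ.* f′ ℚ.* ½
      rearrange = solve-∀ ℚ-almostCommutativeRing
      expand : ℕ→ℚ (5 ℕ.* n ℕ.* fib (2 ℕ.* j) ℕ.* fib (2 ℕ.* j ℕ.* (n ∸ 1))) ≡ five ℚ.* ℕ→ℚ n ℚ.* F ℚ.* F′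
      expand = trans (ℕ→ℚ-* (5 ℕ.* n ℕ.* fib (2 ℕ.* j)) (fib (2 ℕ.* j ℕ.* (n ∸ 1))))
                     (cong (ℚ._* F′) (trans (ℕ→ℚ-* (5 ℕ.* n) (fib (2 ℕ.* j))) (cong (ℚ._* F) (ℕ→ℚ-* 5 n))))

open Embedding using (ι-injective)
open Binet using (module Identity)

open import Data.Nat as ℕ using (ℕ; _≥_; _/_; _∸_; _^_)
open import Data.Nat.Combinatorics using (_C_)
open import Data.Integer using (+_)
open import Data.Rational as ℚ using (ℚ; _*_)
open import Relation.Binary.PropositionalEquality using (_≡_)

-- For j = 0 both sides vanish (F₀ = 0 and 20⁰ − 5⁰ = 0).
corollary10 : (n j : ℕ) → j ≥ 1 →
    sumTo (n / 2) (λ k → ℕ→ℚ (n C (2 ℕ.* k)) * ℕ→ℚ (20 ^ k ∸ 5 ^ k) * ℕ→ℚ (fib (2 ℕ.* j) ^ (2 ℕ.* k)) * B (2 ℕ.* k) * ℕ→ℚ (lucas (2 ℕ.* j ℕ.* (n ∸ 2 ℕ.* k))))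
    ≡ (+ (5 ℕ.* n ℕ.* fib (2 ℕ.* j) ℕ.* fib (2 ℕ.* j ℕ.* (n ∸ 1)))) ℚ./ 2
corollary10 n j _ = ι-injective (trans (sym (series≡sum n)) (series≡closedForm n))
  where open Identity j
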